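{- For every superpermutation $I$, $\pi(Q_I)=L_{\gamma(I)}$.
   Context: $\mathbb{Q}^\theta\langle\langle x\rangle\rangle$: bounded-degree formal power series over $\mathbb{Q}$ in noncommuting $x_1,x_2,\ldots$ and $\theta_1,\theta_2,\ldots$ with $x_i\theta_j=\theta_jx_i$, $\theta_i\theta_j=-\theta_j\theta_i$; $\mathbb{Q}^\theta[[x]]$ is the same with the $x_i$ commuting. $\pi:\mathbb{Q}^\theta\langle\langle x\rangle\rangle\to\mathbb{Q}^\theta[[x]]$ is the abelianization morphism sending each $x_i$ to its commutative counterpart and fixing each $\theta_i$. A set supercomposition of bidegree $(n,m)$ is a sequence $(I_1,\ldots,I_k)$ of nonempty subsets of $\{0,\ldots,n\}$ with $I_i\cap I_j\subseteq\{0\}$ ($i\ne j$), $\bigcup(I_i\setminus\{0\})=[n]$, $m$ blocks containing $0$ (fermionic). For a monic monomial $u$, relabel its index set order-preservingly onto $[k]$ to get $\theta_{i_1}\cdots\theta_{i_m}x_{j_1}\cdots x_{j_n}$ ($i_1<\cdots<i_m$) and set $I(u)=(I_1,\ldots,I_k)$, $I_r=\{t:j_t=r\}\cup(\{0\}$ if $r\in\{i_1,\ldots,i_m\})$; $M_I=\sum_{I(u)=I}u$. Order: $J$ covers $I$ if $J$ arises by replacing two consecutive non-fermionic blocks $I_i,I_{i+1}$ with $\max I_i<\min I_{i+1}$ by their union; $\preceq$ is the reflexive-transitive closure; $Q_I=\sum_{J\succeq I}M_J$. A superpermutation is a set supercomposition whose non-fermionic blocks are singletons. A dotted composition is a finite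 sequence of entries that are positive integers $a$ ($\underline\alpha_i=a,\bar\alpha_i=0$) or $\dot a$, $a\in\mathbb{N}_0$ ($\underline\alpha_i=a,\bar\alpha_i=1$). $M_\alpha=\sum_{i_1<\cdots<i_k}\theta_{i_1}^{\bar\alpha_1}\cdots\theta_{i_k}^{\bar\alpha_k}x_{i_1}^{\underline\alpha_1}\cdots x_{i_k}^{\underline\alpha_k}\in\mathbb{Q}^\theta[[x]]$. Order: $\beta$ covers $\alpha$ if $\beta$ is obtained by replacing two adjacent undotted entries by their sum; $\preceq$ is the reflexive-transitive closure; $L_\alpha=\sum_{\beta\preceq\alpha}M_\beta$. For a superpermutation $I$: a non-fermionic segment is a maximal interval $[p,q]$ with $I_p,\ldots,I_q$ non-fermionic, $I_i=\{a_i\}$; with $d_1<\cdots<d_s$ the $d\in[q-p]$ such that $a_{p+d-1}>a_{p+d}$, $\alpha_{[p,q]}=(d_1,d_2-d_1,\ldots,(q-p+1)-d_s)$ (or $(q-p+1)$ if $s=0$). $\gamma(I)$ concatenates, in order of appearance, a part $\dot a$ with $a=|I_i|-1$ for each fermionic block and $\alpha_{[p,q]}$ for each non-fermionic segment. -}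

module Defs where

open import Data.Nat using (ℕ; zero; suc; _+_; _∸_; _<_; _≤_; _<ᵇ_; _≤ᵇ_; _⊔_; _≤?_)
open import Data.Nat.Properties using (_≟_)
open import Data.Bool using (Bool; true; false; if_then_else_; not; _∧_)
open import Data.List using (List; []; _∷_; _++_; map; concatMap; filter; length; upTo; reverse; replicate; concat; lookup; foldr; deduplicate)
open import Data.Nat.ListAction using (sum)
import Data.List.Properties as LP
open import Data.List.Membership.Propositional using (_∈_)
open import Data.List.Membership.DecPropositional _≟_ using (_∈?_)
open import Data.List.Relation.Unary.All using (All)
open import Data.List.Relation.Unary.Linked using (Linked)
open import Data.Product using (_×_; _,_; Σ; ∃; proj₁; proj₂)
import Data.Product.Properties as PP
import Data.Bool.Properties as BP

allᵇ : {A : Set} → (A → Bool) → List A → Bool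
allᵇ p [] = true
allᵇ p (x ∷ xs) = p x ∧ allᵇ p xs
open import Data.Fin using (Fin)
open import Relation.Binary.PropositionalEquality using (_≡_; _≢_)
open import Relation.Nullary using (does; ¬_)
open import Relation.Binary using (DecidableEquality)

-- Conventions.  The variable x_{i+1} (resp. θ_{i+1}) of the paper is
-- represented by the natural number i (an order-preserving relabelling).
--
-- A monic monomial of Q^θ⟨⟨x⟩⟩ is written uniquely as
--   θ_{i1} ⋯ θ_{im} x_{j1} ⋯ x_{jn}   with i1 < ⋯ < im,
-- and is represented by the pair (θ-index list, x-index word).
-- A monic monomial of Q^θ[[x]] is written uniquely as
--   θ_{i1} ⋯ θ_{im} x_{j1} ⋯ x_{jn}   with i1 < ⋯ < im and j1 ≤ ⋯ ≤ jn,
-- and is represented by the same kind of pair (normal form).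
-- A series is represented by its coefficient function on monic monomials.
-- All series occurring here are sums of monic monomials, so their
-- coefficients are natural numbers (ℕ ⊆ ℚ).

Mon : Set
Mon = List ℕ × List ℕ

_≟M_ : DecidableEquality Mon
_≟M_ = PP.≡-dec (LP.≡-dec _≟_) (LP.≡-dec _≟_)

IsCMon : Mon → Set
IsCMon (S , e) = Linked _<_ S × Linked _≤_ e

insert : ℕ → List ℕ → List ℕ
insert a [] = a ∷ []
insert a (b ∷ bs) = if a ≤ᵇ b then a ∷ b ∷ bs else b ∷ insert a bs

isort : List ℕ → List ℕ
isort [] = []
isort (a ∷ as) = insert a (isort as)

-- π on monic monomials: x's become commutative, θ's are fixed
πmon : Mon → Mon
πmon (S , w) = (S , isort w)

words : ℕ → List ℕ → List (List ℕ)
words zero A = [] ∷ []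
words (suc n) A = concatMap (λ a → map (a ∷_) (words n A)) A

sublists : ℕ → List ℕ → List (List ℕ)
sublists zero _ = [] ∷ []
sublists (suc k) [] = []
sublists (suc k) (x ∷ xs) = map (x ∷_) (sublists k xs) ++ sublists (suc k) xs

maxIdx : Mon → ℕ
maxIdx (S , e) = foldr _⊔_ 0 (S ++ e)

-- the indices 0..maxIdx w: every variable occurring in w lies here
alphabet : Mon → List ℕ
alphabet w = upTo (suc (maxIdx w))

-- coefficient of a commutative monomial w in π(F), F given by its
-- coefficient function on noncommutative monic monomials:
-- the sum of F(u) over all monic u with π(u) = w.  (Every such u has
-- θ-part equal to that of w and an x-word of length |e| over the
-- variables of w, so the candidates below contain the whole fibre.)
πcoeff : (Mon → ℕ) → Mon → ℕ
πcoeff F (S , e) =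
  sum (map (λ v → F (S , v))
    (filter (λ v → πmon (S , v) ≟M (S , e)) (words (length e) (alphabet (S , e)))))

-- Set supercompositions.  A block (subset of {0,…,n}) is represented by
-- the strictly increasing list of its elements; a set supercomposition
-- is the list of its blocks.

SSC : Set
SSC = List (List ℕ)

_≟S_ : DecidableEquality SSC
_≟S_ = LP.≡-dec (LP.≡-dec _≟_)

fermionic : List ℕ → Bool
fermionic B = does (0 ∈? B)

count0 : SSC → ℕ
count0 I = length (filter (λ B → 0 ∈? B) I)

record IsSetSupercomposition (n m : ℕ) (I : SSC) : Set where
  field
    sorted    : All (Linked _<_) I
    nonempty  : All (λ B → B ≢ []) I
    bounded   : All (All (_≤ n)) I
    disjoint  : (i j : Fin (length I)) → i ≢ j → (t : ℕ) →
                t ∈ lookup I i → t ∈ lookup I j → t ≡ 0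
    covering  : (t : ℕ) → 1 ≤ t → t ≤ n → ∃ λ (i : Fin (length I)) → t ∈ lookup I i
    fermions  : count0 I ≡ m

record IsSuperpermutation (n m : ℕ) (I : SSC) : Set where
  field
    ssc        : IsSetSupercomposition n m I
    singletons : All (λ B → ¬ (0 ∈ B) → length B ≡ 1) I

-- I(u) for a noncommutative monic monomial u = (S , w):
-- K = the index set of u in increasing order; for its r-th element K_r,
-- I_r = {t ∈ [n] : w_t = K_r} ∪ ({0} if K_r ∈ S).
indexSet : Mon → List ℕ
indexSet (S , w) = filter (λ j → j ∈? (S ++ w)) (alphabet (S , w))

positions : ℕ → ℕ → List ℕ → List ℕ
positions j t [] = []
positions j t (a ∷ as) =
  if does (a ≟ j) then t ∷ positions j (suc t) as else positions j (suc t) as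

blockOf : Mon → ℕ → List ℕ
blockOf (S , w) j =
  (if does (j ∈? S) then 0 ∷ [] else []) ++ positions j 1 w

Iof : Mon → SSC
Iof u = map (blockOf u) (indexSet u)

-- coefficient of u in M_J = Σ_{I(u)=J} u
Mcoeff : SSC → Mon → ℕ
Mcoeff J u = if does (Iof u ≟S J) then 1 else 0

-- the covers of I: merge consecutive non-fermionic blocks B, C with
-- max B < min C (i.e. every element of B is below every element of C)
-- into their union (which, as a sorted list, is B ++ C)
mergeable : List ℕ → List ℕ → Bool
mergeable B C = not (fermionic B) ∧ not (fermionic C) ∧
                allᵇ (λ b → allᵇ (λ c → b <ᵇ c) C) B

coversSSC : SSC → List SSC
coversSSC (B ∷ C ∷ rest) =
  (if mergeable B C then ((B ++ C) ∷ rest) ∷ [] else [])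
  ++ map (B ∷_) (coversSSC (C ∷ rest))
coversSSC _ = []

upTo≼ : ℕ → SSC → List SSC
upTo≼ zero I = I ∷ []
upTo≼ (suc k) I = I ∷ concatMap (upTo≼ k) (coversSSC I)

-- {J : I ⪯ J}, without repetitions (each cover shortens the list,
-- so length I steps suffice)
upset : SSC → List SSC
upset I = deduplicate _≟S_ (upTo≼ (length I) I)

-- coefficient of u in Q_I = Σ_{J ⪰ I} M_J
Qcoeff : SSC → Mon → ℕ
Qcoeff I u = sum (map (λ J → Mcoeff J u) (upset I))

-- Dotted compositions: an entry (a , false) is the undotted part a
-- (a ≥ 1), an entry (a , true) is the dotted part ȧ (a ≥ 0).

DC : Set
DC = List (ℕ × Bool)

_≟D_ : DecidableEquality DC
_≟D_ = LP.≡-dec (PP.≡-dec _≟_ BP._≟_)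

-- the monomial θ_{i1}^{ᾱ1}⋯θ_{ik}^{ᾱk} x_{i1}^{α1}⋯x_{ik}^{αk}
-- for an increasing tuple i (as a commutative normal-form monomial)
thetaPart : List ℕ → DC → List ℕ
thetaPart (i ∷ is) ((a , true) ∷ α) = i ∷ thetaPart is α
thetaPart (i ∷ is) ((a , false) ∷ α) = thetaPart is α
thetaPart _ _ = []

xPart : List ℕ → DC → List ℕ
xPart (i ∷ is) ((a , d) ∷ α) = replicate a i ++ xPart is α
xPart _ _ = []

monOf : List ℕ → DC → Mon
monOf is α = (thetaPart is α , xPart is α)

-- coefficient of w in M_α: the number of i1 < ⋯ < ik with monomial w
-- (every index of such a tuple occurs in w, hence lies in alphabet w)
MDcoeff : DC → Mon → ℕ
MDcoeff α w =
  length (filter (λ is → monOf is α ≟M w) (sublists (length α) (alphabet w)))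

-- β with α covering β: split one undotted entry a into b , a ∸ b (0<b<a)
splitsOf : ℕ → List (ℕ × ℕ)
splitsOf a = map (λ b → (b , a ∸ b)) (filter (λ b → 1 ≤? b) (upTo a))

coveredBy : DC → List DC
coveredBy [] = []
coveredBy ((a , true) ∷ α) = map ((a , true) ∷_) (coveredBy α)
coveredBy ((a , false) ∷ α) =
  map (λ p → (proj₁ p , false) ∷ (proj₂ p , false) ∷ α) (splitsOf a)
  ++ map ((a , false) ∷_) (coveredBy α)

size : DC → ℕ
size α = sum (map proj₁ α)

downTo≼ : ℕ → DC → List DC
downTo≼ zero α = α ∷ []
downTo≼ (suc k) α = α ∷ concatMap (downTo≼ k) (coveredBy α)

-- {β : β ⪯ α}, without repetitions (each step lengthens β and β has
-- at most size α undotted entries, so size α steps suffice)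
downset : DC → List DC
downset α = deduplicate _≟D_ (downTo≼ (size α) α)

-- coefficient of w in L_α = Σ_{β ⪯ α} M_β
Lcoeff : DC → Mon → ℕ
Lcoeff α w = sum (map (λ β → MDcoeff β w) (downset α))

-- descent composition of a nonfermionic segment a_p … a_q:
-- a new part starts after each descent a_{i} > a_{i+1}
descGo : ℕ → ℕ → List ℕ → List ℕ
descGo prev c [] = c ∷ []
descGo prev c (b ∷ bs) =
  if b <ᵇ prev then c ∷ descGo b 1 bs else descGo b (suc c) bs

descComp : List ℕ → List ℕ
descComp [] = []
descComp (a ∷ as) = descGo a 1 as

flush : List ℕ → DC
flush revRun = map (λ c → (c , false)) (descComp (reverse revRun))

elem : List ℕ → ℕ
elem (b ∷ _) = b
elem [] = 0

-- accumulator: the current non-fermionic segment, reversed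
gammaAcc : List ℕ → SSC → DC
gammaAcc run [] = flush run
gammaAcc run (B ∷ rest) =
  if fermionic B
  then flush run ++ ((length B ∸ 1 , true) ∷ gammaAcc [] rest)
  else gammaAcc (elem B ∷ run) rest

γ : SSC → DC
γ I = gammaAcc [] I

-- Fix a commutative monomial w = θ_S x^e. It occurs in exactly one M_α, namely for
-- α = monShape w, so its coefficient in L_γ(I) is 1 if monShape w ⪯ γ(I) and 0 otherwise.
-- Its coefficient in π(Q_I) counts the monomials u with π(u) = w and I ⪯ I(u). On this
-- fibre u ↦ I(u) is injective, and its image consists of the set supercompositions of the
-- same ground set whose shape (block sizes, and which blocks are fermionic) is monShape w.
-- Finally, the only blocks of a superpermutation I that can be merged are consecutive
-- singletons {a}, {b} with a < b, so the coarsenings of I merge segments of the maximal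
-- ascending runs of singletons. These runs are the undotted parts of γ(I); hence J ↦ shape J
-- is a bijection from {J : I ⪯ J} onto {β : β ⪯ γ(I)}, and both coefficients equal
-- [monShape w ⪯ γ(I)].

module Submission where

open import Defs
open import Data.Bool using (Bool; true; false; if_then_else_; _∧_; _∨_; T)
open import Data.Bool.Properties using (∧-conicalˡ; ∧-conicalʳ; T-≡)
open import Data.Empty using (⊥; ⊥-elim)
open import Data.Fin using (Fin) renaming (zero to fzero; suc to fsuc)
import Data.Fin.Properties as Fin
open import Data.List
  using ( List; []; _∷_; _++_; map; concat; concatMap; filter; length; upTo; reverse; replicate
        ; lookup; foldr; zip; cartesianProductWith )
import Data.List.Properties as List
open import Data.List.Membership.Propositional using (_∈_; _∉_)
open import Data.List.Membership.Propositional.Properties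
open import Data.List.Relation.Binary.Subset.Propositional using (_⊆_)
import Data.List.Relation.Binary.Subset.Propositional.Properties as Subset
open import Data.List.Relation.Unary.All as All using (All; []; _∷_)
import Data.List.Relation.Unary.All.Properties as All
open import Data.List.Relation.Unary.Any as Any using (Any; here; there)
open import Data.List.Relation.Unary.AllPairs using ([]; _∷_)
import Data.List.Relation.Unary.AllPairs.Properties as AllPairs
open import Data.List.Relation.Unary.Linked as Linked using (Linked; []; [-]; _∷_)
import Data.List.Relation.Unary.Linked.Properties as Linked
open import Data.List.Relation.Unary.Unique.Propositional using (Unique)
import Data.List.Relation.Unary.Unique.Propositional.Properties as Unique
import Data.List.Relation.Unary.Unique.DecPropositional.Properties as DecUnique
open import Data.Nat
open import Data.Nat.ListAction using (sum)
open import Data.Nat.Properties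
open import Data.List.Membership.DecPropositional _≟_ using (_∈?_)
open import Data.List.Membership.DecPropositional _≟D_ using () renaming (_∈?_ to _∈ᵈ?_)
open import Data.Product using (_×_; _,_; ∃-syntax; proj₁; proj₂)
open import Data.Sum using (_⊎_; inj₁; inj₂; [_,_]′)
open import Data.Unit using (⊤; tt)
open import Function using (id; _∘_; case_of_; mk⇔; Equivalence)
open import Relation.Binary.Definitions using (tri<; tri≈; tri>)
open import Relation.Binary.PropositionalEquality
open import Relation.Nullary using (Dec; yes; no; does; proof; ¬_)
open import Relation.Nullary.Reflects using (ofʸ; ofⁿ)
open import Relation.Nullary.Decidable using (dec-true; dec-false; does-⇔)
import Relation.Unary as U
open ≡-Reasoning

if-true : ∀ {A : Set} {b} {x y : A} → b ≡ true → (if b then x else y) ≡ x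
if-true refl = refl

if-false : ∀ {A : Set} {b} {x y : A} → b ≡ false → (if b then x else y) ≡ y
if-false refl = refl

does≡true⇒ : ∀ {P : Set} (d : Dec P) → does d ≡ true → P
does≡true⇒ (yes p) _ = p

<ᵇ≡true : ∀ {m n} → m < n → (m <ᵇ n) ≡ true
<ᵇ≡true m<n = Equivalence.to T-≡ (<⇒<ᵇ m<n)

<ᵇ≡false : ∀ {m n} → ¬ m < n → (m <ᵇ n) ≡ false
<ᵇ≡false {m} {n} m≮n with m <ᵇ n in eq
... | true  = ⊥-elim (m≮n (<ᵇ⇒< m n (Equivalence.from T-≡ eq)))
... | false = refl

head< : ∀ {x xs z} → Linked _<_ (x ∷ xs) → z ∈ xs → x < z
head< {xs = _ ∷ _} (x<y ∷ l) = All.lookup (Linked.Linked⇒All <-trans x<y l)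

head≤ : ∀ {x xs z} → Linked _<_ (x ∷ xs) → z ∈ x ∷ xs → x ≤ z
head≤ _ (here refl) = ≤-refl
head≤ l (there z∈)  = <⇒≤ (head< l z∈)

∷-increasing : ∀ {x xs} → (∀ {z} → z ∈ xs → x < z) → Linked _<_ xs → Linked _<_ (x ∷ xs)
∷-increasing {xs = []}    _     _ = [-]
∷-increasing {xs = _ ∷ _} below l = below (here refl) ∷ l

∈-tail : ∀ {x y : ℕ} {xs} → x ∈ y ∷ xs → x ≢ y → x ∈ xs
∈-tail (here x≡y) x≢y = ⊥-elim (x≢y x≡y)
∈-tail (there x∈) _   = x∈

⊆-tail : ∀ {x y xs ys} → Linked _<_ (x ∷ xs) → x ≡ y → x ∷ xs ⊆ y ∷ ys → xs ⊆ ys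
⊆-tail lx refl sub = Subset.⊆∷∧∉⇒⊆ (sub ∘ there) (λ x∈ → <-irrefl refl (head< lx x∈))

increasing-ext : ∀ {xs ys} → Linked _<_ xs → Linked _<_ ys → xs ⊆ ys → ys ⊆ xs → xs ≡ ys
increasing-ext {[]}    {[]}    _ _ _ _ = refl
increasing-ext {[]}    {_ ∷ _} _ _ _ ys⊆ with () ← ys⊆ (here refl)
increasing-ext {_ ∷ _} {[]}    _ _ xs⊆ _ with () ← xs⊆ (here refl)
increasing-ext {x ∷ xs} {y ∷ ys} lx ly xs⊆ ys⊆ =
  cong₂ _∷_ x≡y (increasing-ext (Linked.tail lx) (Linked.tail ly)
                                (⊆-tail lx x≡y xs⊆) (⊆-tail ly (sym x≡y) ys⊆))
  where
  x≡y : x ≡ y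
  x≡y with xs⊆ (here refl) | ys⊆ (here refl)
  ... | here x≡y | _        = x≡y
  ... | there _  | here y≡x = sym y≡x
  ... | there y∈ | there x∈ = ⊥-elim (<-asym (head< lx x∈) (head< ly y∈))

upTo-increasing : ∀ n → Linked _<_ (upTo n)
upTo-increasing n = Linked.applyUpTo⁺₂ id n n<1+n

≤-foldr-⊔ : ∀ {x} xs → x ∈ xs → x ≤ foldr _⊔_ 0 xs
≤-foldr-⊔ (a ∷ xs) (here refl) = m≤m⊔n a (foldr _⊔_ 0 xs)
≤-foldr-⊔ (a ∷ xs) (there x∈)  = ≤-trans (≤-foldr-⊔ xs x∈) (m≤n⊔m a (foldr _⊔_ 0 xs))

count : ℕ → List ℕ → ℕ
count j []       = 0
count j (a ∷ as) = if does (a ≟ j) then suc (count j as) else count j as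

SameContent : List ℕ → List ℕ → Set
SameContent v e = ∀ i → count i v ≡ count i e

count-++ : ∀ j xs ys → count j (xs ++ ys) ≡ count j xs + count j ys
count-++ j []       ys = refl
count-++ j (a ∷ xs) ys with does (a ≟ j)
... | true  = cong suc (count-++ j xs ys)
... | false = count-++ j xs ys

-- does (a ≟ j) computes to a ≡ᵇ j, so a case split must abstract it (with its
-- proof) rather than a ≟ j itself.
count-∉ : ∀ {j} xs → j ∉ xs → count j xs ≡ 0
count-∉ []       _  = refl
count-∉ {j} (a ∷ xs) j∉ with does (a ≟ j) | proof (a ≟ j)
... | true  | ofʸ refl = ⊥-elim (j∉ (here refl))
... | false | _        = count-∉ xs (j∉ ∘ there)

count-∈ : ∀ {j} xs → j ∈ xs → 0 < count j xs
count-∈ {j} (a ∷ xs) j∈ with does (a ≟ j) | proof (a ≟ j) | j∈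
... | true  | _       | _          = s≤s z≤n
... | false | ofⁿ a≢j | here refl  = ⊥-elim (a≢j refl)
... | false | _       | there j∈xs = count-∈ xs j∈xs

count>0⇒∈ : ∀ {j} xs → 0 < count j xs → j ∈ xs
count>0⇒∈ {j} (a ∷ xs) pos with does (a ≟ j) | proof (a ≟ j)
... | true  | ofʸ refl = here refl
... | false | _        = there (count>0⇒∈ xs pos)

∈-sameContent : ∀ {j v e} → SameContent v e → j ∈ v → j ∈ e
∈-sameContent {j} {v} {e} same j∈ = count>0⇒∈ e (subst (0 <_) (same j) (count-∈ v j∈))

count-replicate : ∀ j k → count j (replicate k j) ≡ k
count-replicate j zero = refl
count-replicate j (suc k) with does (j ≟ j) | proof (j ≟ j)
... | true  | _       = cong suc (count-replicate j k)
... | false | ofⁿ j≢j = ⊥-elim (j≢j refl)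

count-replicate-≢ : ∀ {i j} k → i ≢ j → count j (replicate k i) ≡ 0
count-replicate-≢ {j = j} k i≢j =
  count-∉ (replicate k _) (λ j∈ → All.lookup (All.replicate⁺ {P = _≢ j} k i≢j) j∈ refl)

count-∷ : ∀ j a {xs ys} → count j xs ≡ count j ys → count j (a ∷ xs) ≡ count j (a ∷ ys)
count-∷ j a eq with does (a ≟ j)
... | true  = cong suc eq
... | false = eq

count-∷-≡ : ∀ {a} xs → count a (a ∷ xs) ≡ suc (count a xs)
count-∷-≡ {a} xs with does (a ≟ a) | proof (a ≟ a)
... | true  | _       = refl
... | false | ofⁿ a≢a = ⊥-elim (a≢a refl)

count-insert : ∀ j a xs → count j (insert a xs) ≡ count j (a ∷ xs)
count-insert j a []       = refl
count-insert j a (b ∷ bs) with a ≤ᵇ b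
... | true  = refl
... | false with does (a ≟ j) | does (b ≟ j) | count-insert j a bs
...   | true  | true  | ih = cong suc ih
...   | true  | false | ih = ih
...   | false | true  | ih = cong suc ih
...   | false | false | ih = ih

count-isort : ∀ j xs → count j (isort xs) ≡ count j xs
count-isort j []       = refl
count-isort j (a ∷ xs) =
  trans (count-insert j a (isort xs)) (count-∷ j a {isort xs} {xs} (count-isort j xs))

length-insert : ∀ a xs → length (insert a xs) ≡ suc (length xs)
length-insert a []       = refl
length-insert a (b ∷ bs) with a ≤ᵇ b
... | true  = refl
... | false = cong suc (length-insert a bs)

length-isort : ∀ xs → length (isort xs) ≡ length xs
length-isort []       = refl
length-isort (a ∷ xs) = trans (length-insert a (isort xs)) (cong suc (length-isort xs))

sorted-head≤ : ∀ {a xs} → Linked _≤_ (a ∷ xs) → All (a ≤_) xs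
sorted-head≤ [-]      = []
sorted-head≤ (a≤ ∷ l) = Linked.Linked⇒All ≤-trans a≤ l

∷-sorted : ∀ {b xs} → All (b ≤_) xs → Linked _≤_ xs → Linked _≤_ (b ∷ xs)
∷-sorted []       _ = [-]
∷-sorted (b≤ ∷ _) l = b≤ ∷ l

insert-All : ∀ {P : ℕ → Set} a xs → All P (a ∷ xs) → All P (insert a xs)
insert-All a []       pas             = pas
insert-All a (b ∷ bs) (pa ∷ pb ∷ pbs) with a ≤ᵇ b
... | true  = pa ∷ pb ∷ pbs
... | false = pb ∷ insert-All a bs (pa ∷ pbs)

insert-sorted : ∀ a xs → Linked _≤_ xs → Linked _≤_ (insert a xs)
insert-sorted a []       _ = [-]
insert-sorted a (b ∷ bs) l with a ≤ᵇ b in a≤ᵇb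
... | true  = ≤ᵇ⇒≤ a b (Equivalence.from T-≡ a≤ᵇb) ∷ l
... | false = ∷-sorted (insert-All a bs (b≤a ∷ sorted-head≤ l)) (insert-sorted a bs (Linked.tail l))
  where
  b≤a : b ≤ a
  b≤a = <⇒≤ (≰⇒> (λ a≤b → subst T a≤ᵇb (≤⇒≤ᵇ a≤b)))

isort-sorted : ∀ xs → Linked _≤_ (isort xs)
isort-sorted []       = []
isort-sorted (a ∷ xs) = insert-sorted a (isort xs) (isort-sorted xs)

split-sorted : ∀ j e → Linked _≤_ e → All (j ≤_) e →
               ∃[ r ] e ≡ replicate (count j e) j ++ r × Linked _≤_ r × All (j <_) r
split-sorted j []      _  _            = [] , refl , [] , []
split-sorted j (a ∷ e) le (j≤a ∷ j≤e) with a ≟ j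
... | yes refl =
  let r , e≡ , lr , a<r = split-sorted a e (Linked.tail le) j≤e
  in r , trans (cong (a ∷_) e≡) (cong (λ c → replicate c a ++ r) (sym (count-∷-≡ e))) , lr , a<r
... | no a≢j =
  a ∷ e , cong (λ c → replicate c j ++ a ∷ e) (sym (count-∉ (a ∷ e) j∉)) , le , above-j
  where
  j<a : j < a
  j<a = ≤∧≢⇒< j≤a (a≢j ∘ sym)
  above-j : All (j <_) (a ∷ e)
  above-j = j<a ∷ All.map (<-≤-trans j<a) (sorted-head≤ le)
  j∉ : j ∉ a ∷ e
  j∉ j∈ = <-irrefl refl (All.lookup above-j j∈)

concatMap-replicate-count : ∀ L e → Linked _<_ L → Linked _≤_ e → All (_∈ L) e →
                            concatMap (λ j → replicate (count j e) j) L ≡ e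
concatMap-replicate-count []      []      _  _  _        = refl
concatMap-replicate-count []      (_ ∷ _) _  _  (() ∷ _)
concatMap-replicate-count (j ∷ L) e       lL le e⊆ with split-sorted j e le (All.map (head≤ lL) e⊆)
... | r , e≡ , lr , j<r = begin
  replicate (count j e) j ++ concatMap (λ i → replicate (count i e) i) L
    ≡⟨ cong (λ X → replicate (count j e) j ++ concat X) (List.map-cong-local (All.tabulate tail-counts)) ⟩
  replicate (count j e) j ++ concatMap (λ i → replicate (count i r) i) L
    ≡⟨ cong (replicate (count j e) j ++_)
            (concatMap-replicate-count L r (Linked.tail lL) lr (All.tabulate r⊆L)) ⟩
  replicate (count j e) j ++ r
    ≡⟨ sym e≡ ⟩
  e ∎
  where
  tail-counts : ∀ {i} → i ∈ L → replicate (count i e) i ≡ replicate (count i r) i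
  tail-counts {i} i∈ = cong (λ c → replicate c i) (begin
    count i e                                     ≡⟨ cong (count i) e≡ ⟩
    count i (replicate (count j e) j ++ r)        ≡⟨ count-++ i (replicate (count j e) j) r ⟩
    count i (replicate (count j e) j) + count i r
      ≡⟨ cong (_+ count i r) (count-replicate-≢ (count j e) (<⇒≢ (head< lL i∈))) ⟩
    count i r                                     ∎)
  r⊆L : ∀ {x} → x ∈ r → x ∈ L
  r⊆L x∈ = ∈-tail (All.lookup e⊆ (subst (_ ∈_) (sym e≡) (∈-++⁺ʳ _ x∈))) (>⇒≢ (All.lookup j<r x∈))

sorted-sameContent-≡ : ∀ {x y} → Linked _≤_ x → Linked _≤_ y → SameContent x y → x ≡ y
sorted-sameContent-≡ {x} {y} lx ly same = begin
  x
    ≡⟨ sym (concatMap-replicate-count L x (upTo-increasing _) lx (All.tabulate x⊆L)) ⟩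
  concatMap (λ j → replicate (count j x) j) L
    ≡⟨ cong concat (List.map-cong (λ j → cong (λ c → replicate c j) (same j)) L) ⟩
  concatMap (λ j → replicate (count j y) j) L
    ≡⟨ concatMap-replicate-count L y (upTo-increasing _) ly (All.tabulate (x⊆L ∘ ∈-sameContent (sym ∘ same))) ⟩
  y ∎
  where
  L = upTo (suc (foldr _⊔_ 0 x))
  x⊆L : x ⊆ L
  x⊆L z∈ = ∈-upTo⁺ (s≤s (≤-foldr-⊔ x z∈))

sum-map-≡0 : ∀ {A : Set} (f : A → ℕ) xs → (∀ {x} → x ∈ xs → f x ≡ 0) → sum (map f xs) ≡ 0
sum-map-≡0 f []       _   = refl
sum-map-≡0 f (x ∷ xs) f≡0 = cong₂ _+_ (f≡0 (here refl)) (sum-map-≡0 f xs (f≡0 ∘ there))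

sum-map-≡1 : ∀ {A : Set} (f : A → ℕ) xs {x₀} → Unique xs → x₀ ∈ xs → f x₀ ≡ 1 →
             (∀ {x} → x ∈ xs → x ≢ x₀ → f x ≡ 0) → sum (map f xs) ≡ 1
sum-map-≡1 f (x ∷ xs) (x∉xs ∷ _) (here refl) f≡1 f≡0 =
  cong₂ _+_ f≡1 (sum-map-≡0 f xs (λ y∈ → f≡0 (there y∈) (λ { refl → All.lookup x∉xs y∈ refl })))
sum-map-≡1 f (x ∷ xs) (x∉xs ∷ u) (there x₀∈) f≡1 f≡0 =
  cong₂ _+_ (f≡0 (here refl) (λ { refl → All.lookup x∉xs x₀∈ refl }))
            (sum-map-≡1 f xs u x₀∈ f≡1 (f≡0 ∘ there))

length-filter-≡0 : ∀ {A : Set} {P : A → Set} (P? : U.Decidable P) xs →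
                   (∀ {x} → x ∈ xs → ¬ P x) → length (filter P? xs) ≡ 0
length-filter-≡0 P? xs none = cong length (List.filter-none P? (All.tabulate none))

length-filter-≡1 : ∀ {A : Set} {P : A → Set} (P? : U.Decidable P) xs {x₀} →
                   Unique xs → x₀ ∈ xs → P x₀ → (∀ {x} → x ∈ xs → P x → x ≡ x₀) →
                   length (filter P? xs) ≡ 1
length-filter-≡1 P? xs u x₀∈ Px₀ only =
  singleton (Unique.filter⁺ P? u) (∈-filter⁺ P? x₀∈ Px₀)
    λ x∈ → let x∈xs , Px = ∈-filter⁻ P? x∈ in only x∈xs Px
  where
  singleton : ∀ {y₀ ys} → Unique ys → y₀ ∈ ys → (∀ {y} → y ∈ ys → y ≡ y₀) → length ys ≡ 1
  singleton {ys = _ ∷ []}    _               _ _    = refl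
  singleton {ys = _ ∷ _ ∷ _} ((y≢z ∷ _) ∷ _) _ only =
    ⊥-elim (y≢z (trans (only (here refl)) (sym (only (there (here refl))))))

concatMap-∷≡cartesianProduct : ∀ (W : List (List ℕ)) A →
                               concatMap (λ a → map (a ∷_) W) A ≡ cartesianProductWith _∷_ A W
concatMap-∷≡cartesianProduct W []      = refl
concatMap-∷≡cartesianProduct W (a ∷ A) = cong (map (a ∷_) W ++_) (concatMap-∷≡cartesianProduct W A)

∈-words⁺ : ∀ A v → All (_∈ A) v → v ∈ words (length v) A
∈-words⁺ A []      _          = here refl
∈-words⁺ A (a ∷ v) (a∈ ∷ v⊆) =
  subst (a ∷ v ∈_) (sym (concatMap-∷≡cartesianProduct (words (length v) A) A))
    (∈-cartesianProductWith⁺ _∷_ a∈ (∈-words⁺ A v v⊆))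

words-unique : ∀ n A → Unique A → Unique (words n A)
words-unique zero    A _  = [] ∷ []
words-unique (suc n) A uA =
  subst Unique (sym (concatMap-∷≡cartesianProduct (words n A) A))
    (Unique.cartesianProductWith⁺ _∷_ List.∷-injective uA (words-unique n A uA))

∈-sublists⁻ : ∀ k xs {is} → Linked _<_ xs → is ∈ sublists k xs →
              is ⊆ xs × Linked _<_ is × length is ≡ k
∈-sublists⁻ zero    xs       _  (here refl) = (λ ()) , [] , refl
∈-sublists⁻ (suc k) (x ∷ xs) lx is∈ with ∈-++⁻ (map (x ∷_) (sublists k xs)) is∈
... | inj₂ is∈′ =
  let sub , l , len = ∈-sublists⁻ (suc k) xs (Linked.tail lx) is∈′ in there ∘ sub , l , len
... | inj₁ is∈′ with ∈-map⁻ (x ∷_) is∈′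
...   | is , is∈″ , refl =
  let sub , l , len = ∈-sublists⁻ k xs (Linked.tail lx) is∈″
  in Subset.∷⁺ʳ x sub , ∷-increasing (head< lx ∘ sub) l , cong suc len

sublists-unique : ∀ k xs → Linked _<_ xs → Unique (sublists k xs)
sublists-unique zero    xs       _  = [] ∷ []
sublists-unique (suc k) []       _  = []
sublists-unique (suc k) (x ∷ xs) lx =
  Unique.++⁺ (Unique.map⁺ List.∷-injectiveʳ (sublists-unique k xs (Linked.tail lx)))
             (sublists-unique (suc k) xs (Linked.tail lx)) disjoint
  where
  disjoint : ∀ {v} → v ∈ map (x ∷_) (sublists k xs) × v ∈ sublists (suc k) xs → ⊥
  disjoint (v∈ , v∈′) with ∈-map⁻ (x ∷_) v∈
  ... | _ , _ , refl =
    <-irrefl refl (head< lx (proj₁ (∈-sublists⁻ (suc k) xs (Linked.tail lx) v∈′) (here refl)))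

filter-∈-sublists : ∀ {P : ℕ → Set} (P? : U.Decidable P) xs →
                    filter P? xs ∈ sublists (length (filter P? xs)) xs
filter-∈-sublists P? []       = here refl
filter-∈-sublists P? (x ∷ xs) with does (P? x)
... | true  = ∈-++⁺ˡ (∈-map⁺ (x ∷_) (filter-∈-sublists P? xs))
... | false = skip (filter P? xs) (filter-∈-sublists P? xs)
  where
  skip : ∀ ys → ys ∈ sublists (length ys) xs → ys ∈ sublists (length ys) (x ∷ xs)
  skip []       _   = here refl
  skip (_ ∷ ys) ys∈ = ∈-++⁺ʳ (map (x ∷_) (sublists (length ys) xs)) ys∈

-- Monomials and their shapes

∈-indexSet⁻ : ∀ S w {j} → j ∈ indexSet (S , w) → j ∈ S ++ w
∈-indexSet⁻ S w j∈ = proj₂ (∈-filter⁻ (λ j → j ∈? (S ++ w)) j∈)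

∈-indexSet⁺ : ∀ S w {j} → j ∈ S ++ w → j ∈ indexSet (S , w)
∈-indexSet⁺ S w j∈ =
  ∈-filter⁺ (λ j → j ∈? (S ++ w)) (∈-upTo⁺ (s≤s (≤-foldr-⊔ (S ++ w) j∈))) j∈

indexSet-increasing : ∀ u → Linked _<_ (indexSet u)
indexSet-increasing (S , w) = Linked.filter⁺ (λ j → j ∈? (S ++ w)) <-trans (upTo-increasing _)

indexSet-∈-sublists : ∀ u → indexSet u ∈ sublists (length (indexSet u)) (alphabet u)
indexSet-∈-sublists (S , w) = filter-∈-sublists (λ j → j ∈? (S ++ w)) (alphabet (S , w))

letters-⊆-indexSet : ∀ S v → v ⊆ indexSet (S , v)
letters-⊆-indexSet S v = ∈-indexSet⁺ S v ∘ ∈-++⁺ʳ S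

indexSet-sameContent : ∀ S {v e} → SameContent v e → indexSet (S , v) ≡ indexSet (S , e)
indexSet-sameContent S {v} {e} same =
  increasing-ext (indexSet-increasing (S , v)) (indexSet-increasing (S , e))
    (∈-indexSet⁺ S e ∘ Subset.++⁺ʳ S (∈-sameContent same) ∘ ∈-indexSet⁻ S v)
    (∈-indexSet⁺ S v ∘ Subset.++⁺ʳ S (∈-sameContent (sym ∘ same)) ∘ ∈-indexSet⁻ S e)

positions-≥ : ∀ j t v {x} → x ∈ positions j t v → t ≤ x
positions-≥ j t (a ∷ v) x∈ with does (a ≟ j) | x∈
... | true  | here refl = ≤-refl
... | true  | there x∈′ = <⇒≤ (positions-≥ j (suc t) v x∈′)
... | false | x∈′       = <⇒≤ (positions-≥ j (suc t) v x∈′)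

length-positions : ∀ j t v → length (positions j t v) ≡ count j v
length-positions j t []      = refl
length-positions j t (a ∷ v) with does (a ≟ j)
... | true  = cong suc (length-positions j (suc t) v)
... | false = length-positions j (suc t) v

t∈positions : ∀ a t v → t ∈ positions a t (a ∷ v)
t∈positions a t v with does (a ≟ a) | proof (a ≟ a)
... | true  | _       = here refl
... | false | ofⁿ a≢a = ⊥-elim (a≢a refl)

positions-∷-≢ : ∀ {a j} t v → a ≢ j → positions j t (a ∷ v) ≡ positions j (suc t) v
positions-∷-≢ {a} {j} t v a≢j with does (a ≟ j) | proof (a ≟ j)
... | true  | ofʸ a≡j = ⊥-elim (a≢j a≡j)
... | false | _       = refl

positions-∷-cancel : ∀ j t a v v′ → positions j t (a ∷ v) ≡ positions j t (a ∷ v′) →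
                     positions j (suc t) v ≡ positions j (suc t) v′
positions-∷-cancel j t a v v′ eq with does (a ≟ j)
... | true  = List.∷-injectiveʳ eq
... | false = eq

positions-injective : ∀ L t v v′ → All (_∈ L) v → All (_∈ L) v′ →
                      (∀ {j} → j ∈ L → positions j t v ≡ positions j t v′) → v ≡ v′
positions-injective L t []      []        _ _ _ = refl
positions-injective L t []      (a′ ∷ v′) _ (a′∈ ∷ _) same
  with () ← subst (t ∈_) (sym (same a′∈)) (t∈positions a′ t v′)
positions-injective L t (a ∷ v) []        (a∈ ∷ _) _ same
  with () ← subst (t ∈_) (same a∈) (t∈positions a t v)
positions-injective L t (a ∷ v) (a′ ∷ v′) (a∈ ∷ v⊆) (a′∈ ∷ v′⊆) same with a′ ≟ a
... | yes refl = cong (a ∷_) (positions-injective L (suc t) v v′ v⊆ v′⊆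
                                (λ j∈ → positions-∷-cancel _ t a v v′ (same j∈)))
... | no a′≢a  = ⊥-elim (<-irrefl refl (positions-≥ a (suc t) v′ t∈))
  where
  t∈ : t ∈ positions a (suc t) v′
  t∈ = subst (t ∈_) (trans (same a∈) (positions-∷-≢ t v′ a′≢a)) (t∈positions a t v)

map-≡⇒∈-≡ : ∀ {A B : Set} {f g : A → B} xs → map f xs ≡ map g xs →
            ∀ {x} → x ∈ xs → f x ≡ g x
map-≡⇒∈-≡ (y ∷ xs) eq (here refl) = List.∷-injectiveˡ eq
map-≡⇒∈-≡ (y ∷ xs) eq (there x∈)  = map-≡⇒∈-≡ xs (List.∷-injectiveʳ eq) x∈

Iof-injective : ∀ S {v v′} → SameContent v v′ → Iof (S , v) ≡ Iof (S , v′) → v ≡ v′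
Iof-injective S {v} {v′} same eq =
  positions-injective K 1 v v′ (All.tabulate (letters-⊆-indexSet S v))
    (All.tabulate (subst (v′ ⊆_) (sym K≡) (letters-⊆-indexSet S v′)))
    (λ j∈ → List.++-cancelˡ (if does (_ ∈? S) then 0 ∷ [] else []) _ _ (map-≡⇒∈-≡ K blocks j∈))
  where
  K = indexSet (S , v)
  K≡ : K ≡ indexSet (S , v′)
  K≡ = indexSet-sameContent S same
  blocks : map (blockOf (S , v)) K ≡ map (blockOf (S , v′)) K
  blocks = trans eq (cong (map (blockOf (S , v′))) (sym K≡))

-- π maps every monomial of M_J to a monomial of M_(shape J).
blockShape : List ℕ → ℕ × Bool
blockShape B = if fermionic B then (length B ∸ 1 , true) else (length B , false)

shape : SSC → DC
shape = map blockShape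

shapeOn : List ℕ → Mon → DC
shapeOn is (S , e) = map (λ j → (count j e , does (j ∈? S))) is

-- The unique α such that the commutative monomial w occurs in M_α.
monShape : Mon → DC
monShape w = shapeOn (indexSet w) w

blockShape-nonfermionic : ∀ {B} → 0 ∉ B → blockShape B ≡ (length B , false)
blockShape-nonfermionic {B} 0∉B = if-false (dec-false (0 ∈? B) 0∉B)

blockShape-blockOf : ∀ S v j → blockShape (blockOf (S , v) j) ≡ (count j v , does (j ∈? S))
blockShape-blockOf S v j with does (j ∈? S)
... | true  = cong (_, true) (length-positions j 1 v)
... | false = trans (blockShape-nonfermionic (λ 0∈ → <-irrefl refl (positions-≥ j 1 v 0∈)))
                    (cong (_, false) (length-positions j 1 v))

shape-Iof : ∀ S {v e} → SameContent v e → shape (Iof (S , v)) ≡ monShape (S , e)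
shape-Iof S {v} {e} same = begin
  map blockShape (map (blockOf (S , v)) K) ≡⟨ sym (List.map-∘ K) ⟩
  map (blockShape ∘ blockOf (S , v)) K     ≡⟨ List.map-cong entry K ⟩
  shapeOn K (S , e)                        ≡⟨ cong (λ K → shapeOn K (S , e)) (indexSet-sameContent S same) ⟩
  monShape (S , e)                         ∎
  where
  K = indexSet (S , v)
  entry : ∀ j → blockShape (blockOf (S , v) j) ≡ (count j e , does (j ∈? S))
  entry j = trans (blockShape-blockOf S v j) (cong (_, does (j ∈? S)) (same j))

-- The type DC does not force undotted parts to be positive.
IsDottedComposition : DC → Set
IsDottedComposition = All (λ { (a , dotted) → dotted ≡ false → 1 ≤ a })

thetaPart-⊆ : ∀ is β → thetaPart is β ⊆ is
thetaPart-⊆ (i ∷ is) ((a , true)  ∷ β) (here z≡i) = here z≡i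
thetaPart-⊆ (i ∷ is) ((a , true)  ∷ β) (there z∈) = there (thetaPart-⊆ is β z∈)
thetaPart-⊆ (i ∷ is) ((a , false) ∷ β) z∈         = there (thetaPart-⊆ is β z∈)

xPart-⊆ : ∀ is β → xPart is β ⊆ is
xPart-⊆ (i ∷ is) ((a , d) ∷ β) z∈ with ∈-++⁻ (replicate a i) z∈
... | inj₁ z∈rep = here (All.lookup (All.replicate⁺ {P = _≡ i} a refl) z∈rep)
... | inj₂ z∈X   = there (xPart-⊆ is β z∈X)

∈-replicate : ∀ {a} (i : ℕ) → 1 ≤ a → i ∈ replicate a i
∈-replicate {suc a} i _ = here refl

⊆-monOf : ∀ is β → length is ≡ length β → IsDottedComposition β →
          is ⊆ thetaPart is β ++ xPart is β
⊆-monOf (i ∷ is) ((a , d) ∷ β) len (pos ∷ β-dc) (here refl) = head-occurs d pos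
  where
  head-occurs : ∀ d → (d ≡ false → 1 ≤ a) →
                i ∈ thetaPart (i ∷ is) ((a , d) ∷ β) ++ xPart (i ∷ is) ((a , d) ∷ β)
  head-occurs true  _   = here refl
  head-occurs false pos = ∈-++⁺ʳ (thetaPart is β) (∈-++⁺ˡ (∈-replicate i (pos refl)))
⊆-monOf (i ∷ is) ((a , d) ∷ β) len (_ ∷ β-dc) (there z∈) =
  Subset.++⁺ (theta-grows d) (Subset.xs⊆ys++xs _ (replicate a i)) (⊆-monOf is β (suc-injective len) β-dc z∈)
  where
  theta-grows : ∀ d → thetaPart is β ⊆ thetaPart (i ∷ is) ((a , d) ∷ β)
  theta-grows true  = there
  theta-grows false = id

shapeOn-monOf : ∀ is β → Linked _<_ is → length is ≡ length β → shapeOn is (monOf is β) ≡ β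
shapeOn-monOf []       []            _ _   = refl
shapeOn-monOf (i ∷ is) ((a , d) ∷ β) l len =
  cong₂ _∷_ (cong₂ _,_ head-exponent (head-dot d)) (begin
    map (λ j → (count j (replicate a i ++ X) , does (j ∈? θ d))) is
      ≡⟨ List.map-cong-local (All.tabulate tail-entry) ⟩
    shapeOn is (monOf is β)
      ≡⟨ shapeOn-monOf is β (Linked.tail l) (suc-injective len) ⟩
    β ∎)
  where
  X = xPart is β
  θ : Bool → List ℕ
  θ d = thetaPart (i ∷ is) ((a , d) ∷ β)
  i∉ : ∀ {j} → j ∈ is → i ≢ j
  i∉ = <⇒≢ ∘ head< l
  head-exponent : count i (replicate a i ++ X) ≡ a
  head-exponent = begin
    count i (replicate a i ++ X)        ≡⟨ count-++ i (replicate a i) X ⟩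
    count i (replicate a i) + count i X ≡⟨ cong₂ _+_ (count-replicate i a)
                                                     (count-∉ X (λ i∈ → i∉ (xPart-⊆ is β i∈) refl)) ⟩
    a + 0                               ≡⟨ +-identityʳ a ⟩
    a                                   ∎
  head-dot : ∀ d → does (i ∈? θ d) ≡ d
  head-dot true  = dec-true (i ∈? θ true) (here refl)
  head-dot false = dec-false (i ∈? θ false) (λ i∈ → i∉ (thetaPart-⊆ is β i∈) refl)
  tail-dot : ∀ {j} d → j ∈ is → does (j ∈? θ d) ≡ does (j ∈? thetaPart is β)
  tail-dot {j} true j∈ =
    does-⇔ (mk⇔ (λ j∈θ → ∈-tail j∈θ (i∉ j∈ ∘ sym)) there) (j ∈? θ true) (j ∈? thetaPart is β)
  tail-dot     false _ = refl
  tail-entry : ∀ {j} → j ∈ is →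
               (count j (replicate a i ++ X) , does (j ∈? θ d)) ≡ (count j X , does (j ∈? thetaPart is β))
  tail-entry {j} j∈ = cong₂ _,_
    (trans (count-++ j (replicate a i) X) (cong (_+ count j X) (count-replicate-≢ a (i∉ j∈))))
    (tail-dot d j∈)

module _ {is β} (l : Linked _<_ is) (len : length is ≡ length β) (β-dc : IsDottedComposition β) where

  indexSet-monOf : indexSet (monOf is β) ≡ is
  indexSet-monOf = increasing-ext (indexSet-increasing (monOf is β)) l
    ([ thetaPart-⊆ is β , xPart-⊆ is β ]′ ∘ ∈-++⁻ (thetaPart is β)
                                          ∘ ∈-indexSet⁻ (thetaPart is β) (xPart is β))
    (∈-indexSet⁺ (thetaPart is β) (xPart is β) ∘ ⊆-monOf is β len β-dc)

  monShape-monOf : monShape (monOf is β) ≡ β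
  monShape-monOf = trans (cong (λ K → shapeOn K (monOf is β)) indexSet-monOf) (shapeOn-monOf is β l len)

thetaPart-shapeOn : ∀ (c : ℕ → ℕ) S L →
                    thetaPart L (map (λ j → (c j , does (j ∈? S))) L) ≡ filter (_∈? S) L
thetaPart-shapeOn c S []      = refl
thetaPart-shapeOn c S (j ∷ L) with does (j ∈? S)
... | true  = cong (j ∷_) (thetaPart-shapeOn c S L)
... | false = thetaPart-shapeOn c S L

xPart-shapeOn : ∀ (c : ℕ → ℕ) (b : ℕ → Bool) L →
                xPart L (map (λ j → (c j , b j)) L) ≡ concatMap (λ j → replicate (c j) j) L
xPart-shapeOn c b []      = refl
xPart-shapeOn c b (j ∷ L) = cong (replicate (c j) j ++_) (xPart-shapeOn c b L)

monOf-monShape : ∀ {w} → IsCMon w → monOf (indexSet w) (monShape w) ≡ w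
monOf-monShape {S , e} (S↗ , e↗) = cong₂ _,_
  (trans (thetaPart-shapeOn (λ j → count j e) S K)
         (increasing-ext (Linked.filter⁺ (_∈? S) <-trans K↗) S↗
            (proj₂ ∘ ∈-filter⁻ (_∈? S) {xs = K})
            (λ j∈ → ∈-filter⁺ (_∈? S) (∈-indexSet⁺ S e (∈-++⁺ˡ j∈)) j∈)))
  (trans (xPart-shapeOn (λ j → count j e) (λ j → does (j ∈? S)) K)
         (concatMap-replicate-count K e K↗ e↗ (All.tabulate (letters-⊆-indexSet S e))))
  where
  K  = indexSet (S , e)
  K↗ = indexSet-increasing (S , e)

monShape-isDC : ∀ w → IsDottedComposition (monShape w)
monShape-isDC (S , e) = All.map⁺ {xs = indexSet (S , e)} (All.tabulate positive)
  where
  positive : ∀ {j} → j ∈ indexSet (S , e) → does (j ∈? S) ≡ false → 1 ≤ count j e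
  positive {j} j∈ j∉S with ∈-++⁻ S (∈-indexSet⁻ S e j∈)
  ... | inj₁ j∈S = case trans (sym (dec-true (j ∈? S) j∈S)) j∉S of λ ()
  ... | inj₂ j∈e = count-∈ e j∈e

MDcoeff-monShape : ∀ {w} → IsCMon w → MDcoeff (monShape w) w ≡ 1
MDcoeff-monShape {w} w-cmon =
  length-filter-≡1 (λ is → monOf is (monShape w) ≟M w) (sublists (length (monShape w)) (alphabet w))
    (sublists-unique (length (monShape w)) (alphabet w) (upTo-increasing _)) K∈ (monOf-monShape w-cmon) only
  where
  K∈ : indexSet w ∈ sublists (length (monShape w)) (alphabet w)
  K∈ = subst (λ k → indexSet w ∈ sublists k (alphabet w)) (sym (List.length-map _ (indexSet w)))
             (indexSet-∈-sublists w)
  only : ∀ {is} → is ∈ sublists (length (monShape w)) (alphabet w) →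
         monOf is (monShape w) ≡ w → is ≡ indexSet w
  only is∈ eq = let _ , l , len = ∈-sublists⁻ _ (alphabet w) (upTo-increasing _) is∈
                in trans (sym (indexSet-monOf l len (monShape-isDC w))) (cong indexSet eq)

MDcoeff-≢monShape : ∀ {β} w → IsDottedComposition β → β ≢ monShape w → MDcoeff β w ≡ 0
MDcoeff-≢monShape {β} w β-dc β≢ =
  length-filter-≡0 (λ is → monOf is β ≟M w) (sublists (length β) (alphabet w)) λ is∈ eq →
    let _ , l , len = ∈-sublists⁻ _ (alphabet w) (upTo-increasing _) is∈
    in β≢ (trans (sym (monShape-monOf l len β-dc)) (cong monShape eq))

-- The orders on set supercompositions and on dotted compositions

infixr 5 _◅_
data Chain {A : Set} (step : A → List A) : ℕ → A → A → Set where
  ε   : ∀ {k x} → Chain step k x x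
  _◅_ : ∀ {k x y z} → y ∈ step x → Chain step k y z → Chain step (suc k) x z

Chain-mono : ∀ {A step k k′} {x y : A} → k ≤ k′ → Chain step k x y → Chain step k′ x y
Chain-mono _         ε         = ε
Chain-mono (s≤s k≤) (y∈ ◅ ch) = y∈ ◅ Chain-mono k≤ ch

Chain-snoc : ∀ {A step k} {x y z : A} → Chain step k x y → z ∈ step y → Chain step (suc k) x z
Chain-snoc ε         z∈ = z∈ ◅ ε
Chain-snoc (y∈ ◅ ch) z∈ = y∈ ◅ Chain-snoc ch z∈

module BoundedReach {A : Set} (step : A → List A) (reach : ℕ → A → List A)
                    (reach-zero : ∀ x → reach zero x ≡ x ∷ [])
                    (reach-suc : ∀ k x → reach (suc k) x ≡ x ∷ concatMap (reach k) (step x)) where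

  ∈-reach⁻ : ∀ k x {y} → y ∈ reach k x → Chain step k x y
  ∈-reach⁻ zero    x y∈ with subst (_ ∈_) (reach-zero x) y∈
  ... | here refl = ε
  ∈-reach⁻ (suc k) x y∈ with subst (_ ∈_) (reach-suc k x) y∈
  ... | here refl = ε
  ... | there y∈′ = first (step x) id (∈-concatMap⁻ (reach k) {xs = step x} y∈′)
    where
    first : ∀ zs → zs ⊆ step x → Any (λ z → _ ∈ reach k z) zs → Chain step (suc k) x _
    first (z ∷ _)  sub (here y∈z)   = sub (here refl) ◅ ∈-reach⁻ k z y∈z
    first (_ ∷ zs) sub (there y∈zs) = first zs (sub ∘ there) y∈zs

  ∈-reach⁺ : ∀ {k x y} → Chain step k x y → y ∈ reach k x
  ∈-reach⁺ {zero}  {x} ε = subst (_ ∈_) (sym (reach-zero x)) (here refl)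
  ∈-reach⁺ {suc k} {x} ε = subst (_ ∈_) (sym (reach-suc k x)) (here refl)
  ∈-reach⁺ {suc k} {x} (y∈ ◅ ch) =
    subst (_ ∈_) (sym (reach-suc k x))
      (there (∈-concatMap⁺ (reach k) (Any.map (λ { refl → ∈-reach⁺ ch }) y∈)))

allᵇ⁻ : ∀ {A : Set} (p : A → Bool) xs → allᵇ p xs ≡ true → ∀ {x} → x ∈ xs → p x ≡ true
allᵇ⁻ p (y ∷ xs) eq (here refl) = ∧-conicalˡ _ _ eq
allᵇ⁻ p (y ∷ xs) eq (there x∈)  = allᵇ⁻ p xs (∧-conicalʳ _ _ eq) x∈

allᵇ⁺ : ∀ {A : Set} (p : A → Bool) xs → (∀ {x} → x ∈ xs → p x ≡ true) → allᵇ p xs ≡ true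
allᵇ⁺ p []       _   = refl
allᵇ⁺ p (y ∷ xs) all = cong₂ _∧_ (all (here refl)) (allᵇ⁺ p xs (all ∘ there))

Mergeable : List ℕ → List ℕ → Set
Mergeable B C = 0 ∉ B × 0 ∉ C × (∀ {b c} → b ∈ B → c ∈ C → b < c)

mergeable⇒ : ∀ B C → mergeable B C ≡ true → Mergeable B C
mergeable⇒ B C eq with 0 ∈? B | 0 ∈? C | eq
... | yes _  | _      | ()
... | no _   | yes _  | ()
... | no 0∉B | no 0∉C | eq′ = 0∉B , 0∉C , λ b∈ c∈ →
  <ᵇ⇒< _ _ (Equivalence.from T-≡ (allᵇ⁻ _ C (allᵇ⁻ _ B eq′ b∈) c∈))

mergeable⇐ : ∀ B C → Mergeable B C → mergeable B C ≡ true
mergeable⇐ B C (0∉B , 0∉C , B<C) with 0 ∈? B | 0 ∈? C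
... | yes 0∈B | _       = ⊥-elim (0∉B 0∈B)
... | no _    | yes 0∈C = ⊥-elim (0∉C 0∈C)
... | no _    | no _    =
  allᵇ⁺ _ B (λ b∈ → allᵇ⁺ _ C (λ c∈ → <ᵇ≡true (B<C b∈ c∈)))

-- I ≼ˢ J is I ⪯ J: J arises from I by merging runs of consecutive blocks.
infix 4 _≼ˢ_
data _≼ˢ_ : SSC → SSC → Set where
  nilˢ   : [] ≼ˢ []
  keepˢ  : ∀ {B I J} → I ≼ˢ J → B ∷ I ≼ˢ B ∷ J
  mergeˢ : ∀ {B C I J} → I ≼ˢ C ∷ J → Mergeable B C → B ∷ I ≼ˢ (B ++ C) ∷ J

≼ˢ-refl : ∀ I → I ≼ˢ I
≼ˢ-refl []      = nilˢ
≼ˢ-refl (B ∷ I) = keepˢ (≼ˢ-refl I)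

≼ˢ-concat : ∀ {I J} → I ≼ˢ J → concat J ≡ concat I
≼ˢ-concat nilˢ                            = refl
≼ˢ-concat (keepˢ {B} I≼J)                 = cong (B ++_) (≼ˢ-concat I≼J)
≼ˢ-concat (mergeˢ {B} {C} {J = J} I≼CJ _) =
  trans (List.++-assoc B C (concat J)) (cong (B ++_) (≼ˢ-concat I≼CJ))

∈-coversSSC⁺ˡ : ∀ {B C rest} → Mergeable B C → (B ++ C) ∷ rest ∈ coversSSC (B ∷ C ∷ rest)
∈-coversSSC⁺ˡ {B} {C} m rewrite mergeable⇐ B C m = here refl

∈-coversSSC⁺ʳ : ∀ {B C rest I₂} → I₂ ∈ coversSSC (C ∷ rest) →
                B ∷ I₂ ∈ coversSSC (B ∷ C ∷ rest)
∈-coversSSC⁺ʳ {B} {C} I₂∈ = ∈-++⁺ʳ (if mergeable B C then _ else []) (∈-map⁺ (B ∷_) I₂∈)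

∈-coversSSC⁻ : ∀ B C rest {I₁} → I₁ ∈ coversSSC (B ∷ C ∷ rest) →
               (I₁ ≡ (B ++ C) ∷ rest × Mergeable B C) ⊎
               (∃[ I₂ ] I₂ ∈ coversSSC (C ∷ rest) × I₁ ≡ B ∷ I₂)
∈-coversSSC⁻ B C rest I₁∈ with mergeable B C in eq | I₁∈
... | true  | here refl  = inj₁ (refl , mergeable⇒ B C eq)
... | true  | there I₁∈′ = inj₂ (∈-map⁻ (B ∷_) I₁∈′)
... | false | I₁∈′       = inj₂ (∈-map⁻ (B ∷_) I₁∈′)

Mergeable-++ˡ : ∀ {B C Y} → Mergeable (B ++ C) Y → Mergeable C Y
Mergeable-++ˡ {B} (0∉BC , 0∉Y , BC<Y) = 0∉BC ∘ ∈-++⁺ʳ B , 0∉Y , BC<Y ∘ ∈-++⁺ʳ B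

Mergeable-++ʳ : ∀ {B C Y} → Mergeable B C → Mergeable (B ++ C) Y → Mergeable B (C ++ Y)
Mergeable-++ʳ {B} {C} (0∉B , 0∉C , B<C) (_ , 0∉Y , BC<Y) =
  0∉B , [ 0∉C , 0∉Y ]′ ∘ ∈-++⁻ C ,
  λ b∈ c∈ → [ B<C b∈ , BC<Y (∈-++⁺ˡ b∈) ]′ (∈-++⁻ C c∈)

merge-≼ˢ : ∀ {B C rest K} → Mergeable B C → (B ++ C) ∷ rest ≼ˢ K → B ∷ C ∷ rest ≼ˢ K
merge-≼ˢ m (keepˢ rest≼J)                = mergeˢ (keepˢ rest≼J) m
merge-≼ˢ {B} {C} m (mergeˢ {C = Y} rest≼YJ m′) =
  subst (λ X → _ ≼ˢ X ∷ _) (sym (List.++-assoc B C Y))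
    (mergeˢ (mergeˢ rest≼YJ (Mergeable-++ˡ {B} m′)) (Mergeable-++ʳ m m′))

covers-≼ˢ : ∀ I {I₁ K} → I₁ ∈ coversSSC I → I₁ ≼ˢ K → I ≼ˢ K
covers-≼ˢ (B ∷ C ∷ rest) I₁∈ I₁≼K with ∈-coversSSC⁻ B C rest I₁∈ | I₁≼K
... | inj₁ (refl , m)         | _               = merge-≼ˢ m I₁≼K
... | inj₂ (_ , I₂∈ , refl)   | keepˢ I₂≼J      = keepˢ (covers-≼ˢ (C ∷ rest) I₂∈ I₂≼J)
... | inj₂ (_ , I₂∈ , refl)   | mergeˢ I₂≼YJ m  = mergeˢ (covers-≼ˢ (C ∷ rest) I₂∈ I₂≼YJ) m

CoverChain : ℕ → SSC → SSC → Set
CoverChain = Chain coversSSC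

module CoverReach = BoundedReach coversSSC upTo≼ (λ _ → refl) (λ _ _ → refl)

CoverChain-∷ : ∀ {k I J} B → CoverChain k I J → CoverChain k (B ∷ I) (B ∷ J)
CoverChain-∷ B ε                              = ε
CoverChain-∷ B (_◅_ {x = C ∷ rest} I₁∈ ch) = ∈-coversSSC⁺ʳ I₁∈ ◅ CoverChain-∷ B ch

CoverChain⇒≼ˢ : ∀ {k I J} → CoverChain k I J → I ≼ˢ J
CoverChain⇒≼ˢ {I = I} ε          = ≼ˢ-refl I
CoverChain⇒≼ˢ {I = I} (I₁∈ ◅ ch) = covers-≼ˢ I I₁∈ (CoverChain⇒≼ˢ ch)

≼ˢ⇒CoverChain : ∀ {I J} → I ≼ˢ J → CoverChain (length I) I J
≼ˢ⇒CoverChain nilˢ              = ε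
≼ˢ⇒CoverChain (keepˢ I≼J)       = Chain-mono (n≤1+n _) (CoverChain-∷ _ (≼ˢ⇒CoverChain I≼J))
≼ˢ⇒CoverChain (mergeˢ I≼CJ m)   =
  Chain-snoc (CoverChain-∷ _ (≼ˢ⇒CoverChain I≼CJ)) (∈-coversSSC⁺ˡ m)

∈-upset⁻ : ∀ I {J} → J ∈ upset I → I ≼ˢ J
∈-upset⁻ I J∈ =
  CoverChain⇒≼ˢ (CoverReach.∈-reach⁻ (length I) I (∈-deduplicate⁻ _≟S_ (upTo≼ (length I) I) J∈))

∈-upset⁺ : ∀ {I J} → I ≼ˢ J → J ∈ upset I
∈-upset⁺ I≼J = ∈-deduplicate⁺ _≟S_ (CoverReach.∈-reach⁺ (≼ˢ⇒CoverChain I≼J))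

-- β ≼ᵈ α is β ⪯ α: β arises from α by splitting undotted parts.
infix 4 _≼ᵈ_
data _≼ᵈ_ : DC → DC → Set where
  nilᵈ   : [] ≼ᵈ []
  dotᵈ   : ∀ {a β α} → β ≼ᵈ α → (a , true) ∷ β ≼ᵈ (a , true) ∷ α
  keepᵈ  : ∀ {a β α} → β ≼ᵈ α → (a , false) ∷ β ≼ᵈ (a , false) ∷ α
  splitᵈ : ∀ {a b c β α} → a + b ≡ c → 1 ≤ a → 1 ≤ b →
           β ≼ᵈ (b , false) ∷ α → (a , false) ∷ β ≼ᵈ (c , false) ∷ α

≼ᵈ-refl : ∀ α → α ≼ᵈ α
≼ᵈ-refl []                = nilᵈ
≼ᵈ-refl ((a , true)  ∷ α) = dotᵈ (≼ᵈ-refl α)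
≼ᵈ-refl ((a , false) ∷ α) = keepᵈ (≼ᵈ-refl α)

merge-≼ᵈ : ∀ {x y α γ} → 1 ≤ x → 1 ≤ y →
           γ ≼ᵈ (x , false) ∷ (y , false) ∷ α → γ ≼ᵈ (x + y , false) ∷ α
merge-≼ᵈ         1≤x 1≤y (keepᵈ γ≼)                           = splitᵈ refl 1≤x 1≤y γ≼
merge-≼ᵈ {y = y} 1≤x 1≤y (splitᵈ {a = p} {b = q} refl 1≤p 1≤q γ≼) =
  splitᵈ (sym (+-assoc p q y)) 1≤p (≤-trans 1≤q (m≤m+n q y)) (merge-≼ᵈ 1≤q 1≤y γ≼)

Split : ℕ → DC → DC → Set
Split a α β = ∃[ x ] ∃[ y ] β ≡ (x , false) ∷ (y , false) ∷ α × 1 ≤ x × 1 ≤ y × x + y ≡ a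

∈-coveredBy⁺ˡ : ∀ {x y a α} → 1 ≤ x → 1 ≤ y → x + y ≡ a →
                (x , false) ∷ (y , false) ∷ α ∈ coveredBy ((a , false) ∷ α)
∈-coveredBy⁺ˡ {x} {y} {α = α} 1≤x 1≤y refl =
  ∈-++⁺ˡ (subst (λ z → (x , false) ∷ (z , false) ∷ α ∈ map _ (splitsOf (x + y))) (m+n∸m≡n x y)
    (∈-map⁺ _ (∈-map⁺ (λ b → (b , x + y ∸ b))
      (∈-filter⁺ (1 ≤?_) (∈-upTo⁺ (m<m+n x 1≤y)) 1≤x))))

∈-coveredBy⁻ : ∀ {a α β} → β ∈ coveredBy ((a , false) ∷ α) →
               Split a α β ⊎ (∃[ β′ ] β′ ∈ coveredBy α × β ≡ (a , false) ∷ β′)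
∈-coveredBy⁻ {a} {α} β∈
  with ∈-++⁻ (map (λ p → (proj₁ p , false) ∷ (proj₂ p , false) ∷ α) (splitsOf a)) β∈
... | inj₂ β∈′ = inj₂ (∈-map⁻ ((a , false) ∷_) β∈′)
... | inj₁ β∈′ with ∈-map⁻ _ β∈′
...   | _ , p∈ , refl with ∈-map⁻ (λ b → (b , a ∸ b)) p∈
...     | b , b∈ , refl with ∈-filter⁻ (1 ≤?_) {xs = upTo a} b∈
...       | b<a , 1≤b =
  inj₁ (b , a ∸ b , refl , 1≤b , m<n⇒0<n∸m (∈-upTo⁻ b<a) , m+[n∸m]≡n (<⇒≤ (∈-upTo⁻ b<a)))

coveredBy-≼ᵈ : ∀ α {β γ} → β ∈ coveredBy α → γ ≼ᵈ β → γ ≼ᵈ α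
coveredBy-≼ᵈ ((a , true) ∷ α) β∈ γ≼β with ∈-map⁻ ((a , true) ∷_) β∈ | γ≼β
... | _ , β′∈ , refl | dotᵈ γ≼β′ = dotᵈ (coveredBy-≼ᵈ α β′∈ γ≼β′)
coveredBy-≼ᵈ ((a , false) ∷ α) β∈ γ≼β with ∈-coveredBy⁻ {a} {α} β∈ | γ≼β
... | inj₁ (_ , _ , refl , 1≤x , 1≤y , refl) | _ = merge-≼ᵈ 1≤x 1≤y γ≼β
... | inj₂ (_ , β′∈ , refl) | keepᵈ γ≼β′           = keepᵈ (coveredBy-≼ᵈ α β′∈ γ≼β′)
... | inj₂ (_ , β′∈ , refl) | splitᵈ e 1≤p 1≤q γ≼ =
  splitᵈ e 1≤p 1≤q (coveredBy-≼ᵈ (_ ∷ α) (∈-++⁺ʳ (map _ (splitsOf _)) (∈-map⁺ _ β′∈)) γ≼)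

SplitChain : ℕ → DC → DC → Set
SplitChain = Chain coveredBy

module SplitReach = BoundedReach coveredBy downTo≼ (λ _ → refl) (λ _ _ → refl)

SplitChain-∷ : ∀ {k α β} x → SplitChain k α β → SplitChain k (x ∷ α) (x ∷ β)
SplitChain-∷ x           ε         = ε
SplitChain-∷ (a , true)  (β∈ ◅ ch) = ∈-map⁺ ((a , true) ∷_) β∈ ◅ SplitChain-∷ (a , true) ch
SplitChain-∷ (a , false) (β∈ ◅ ch) =
  ∈-++⁺ʳ (map _ (splitsOf a)) (∈-map⁺ ((a , false) ∷_) β∈) ◅ SplitChain-∷ (a , false) ch

SplitChain⇒≼ᵈ : ∀ {k α β} → SplitChain k α β → β ≼ᵈ α
SplitChain⇒≼ᵈ {α = α} ε         = ≼ᵈ-refl α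
SplitChain⇒≼ᵈ {α = α} (β∈ ◅ ch) = coveredBy-≼ᵈ α β∈ (SplitChain⇒≼ᵈ ch)

≼ᵈ⇒SplitChain : ∀ {α β} → β ≼ᵈ α → SplitChain (size α) α β
≼ᵈ⇒SplitChain nilᵈ = ε
≼ᵈ⇒SplitChain {(a , _) ∷ α} (dotᵈ β≼α)  =
  Chain-mono (m≤n+m (size α) a) (SplitChain-∷ _ (≼ᵈ⇒SplitChain β≼α))
≼ᵈ⇒SplitChain {(a , _) ∷ α} (keepᵈ β≼α) =
  Chain-mono (m≤n+m (size α) a) (SplitChain-∷ _ (≼ᵈ⇒SplitChain β≼α))
≼ᵈ⇒SplitChain {(c , _) ∷ α} (splitᵈ {a = x} {b = y} refl 1≤x 1≤y β≼) =
  Chain-mono (+-monoˡ-≤ (size α) (+-monoˡ-≤ y 1≤x))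
    (∈-coveredBy⁺ˡ 1≤x 1≤y refl ◅ SplitChain-∷ (x , false) (≼ᵈ⇒SplitChain β≼))

∈-downset⁻ : ∀ α {β} → β ∈ downset α → β ≼ᵈ α
∈-downset⁻ α β∈ =
  SplitChain⇒≼ᵈ (SplitReach.∈-reach⁻ (size α) α (∈-deduplicate⁻ _≟D_ (downTo≼ (size α) α) β∈))

∈-downset⁺ : ∀ {α β} → β ≼ᵈ α → β ∈ downset α
∈-downset⁺ β≼α = ∈-deduplicate⁺ _≟D_ (SplitReach.∈-reach⁺ (≼ᵈ⇒SplitChain β≼α))

-- The composition γ

addHead : ℕ → DC → DC
addHead k []            = []
addHead k ((a , d) ∷ α) = (k + a , d) ∷ α

addHead-0 : ∀ α → addHead 0 α ≡ α
addHead-0 []      = refl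
addHead-0 (_ ∷ _) = refl

addHead-+ : ∀ k l α → addHead k (addHead l α) ≡ addHead (k + l) α
addHead-+ k l []            = refl
addHead-+ k l ((a , d) ∷ α) = cong (λ x → (x , d) ∷ α) (sym (+-assoc k l a))

-- Whether a non-fermionic block with first element b is the last one of its part of γ.
endsPart : ℕ → SSC → Bool
endsPart b []      = true
endsPart b (C ∷ _) = fermionic C ∨ (elem C <ᵇ b)

mutual
  γ′ : SSC → DC
  γ′ []      = []
  γ′ (B ∷ I) = if fermionic B then (length B ∸ 1 , true) ∷ γ′ I else γ-run (elem B) I

  γ-run : ℕ → SSC → DC
  γ-run b I = if endsPart b I then (1 , false) ∷ γ′ I else addHead 1 (γ′ I)

lastOr : ℕ → List ℕ → ℕ
lastOr p []       = p
lastOr p (y ∷ ys) = lastOr y ys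

incLast : List ℕ → List ℕ
incLast []           = []
incLast (x ∷ [])     = suc x ∷ []
incLast (x ∷ y ∷ xs) = x ∷ incLast (y ∷ xs)

-- How appending a letter changes the descent composition: a descent opens a new part.
snocComp : List ℕ → Bool → List ℕ
snocComp L true  = L ++ 1 ∷ []
snocComp L false = incLast L

descGo-snoc : ∀ p c ys z → descGo p c (ys ++ z ∷ []) ≡ snocComp (descGo p c ys) (z <ᵇ lastOr p ys)
descGo-snoc p c []       z with z <ᵇ p
... | true  = refl
... | false = refl
descGo-snoc p c (y ∷ ys) z with y <ᵇ p
... | false = descGo-snoc y (suc c) ys z
... | true  = trans (cong (c ∷_) (descGo-snoc y 1 ys z))
                    (snocComp-∷ (descGo-nonempty y 1 ys) (z <ᵇ lastOr y ys))
  where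
  descGo-nonempty : ∀ p c ys → ∃[ x ] ∃[ xs ] descGo p c ys ≡ x ∷ xs
  descGo-nonempty p c []       = c , [] , refl
  descGo-nonempty p c (y ∷ ys) with y <ᵇ p
  ... | true  = c , descGo y 1 ys , refl
  ... | false = descGo-nonempty y (suc c) ys
  snocComp-∷ : ∀ {L} → (∃[ x ] ∃[ xs ] L ≡ x ∷ xs) → ∀ t → c ∷ snocComp L t ≡ snocComp (c ∷ L) t
  snocComp-∷ _                 true  = refl
  snocComp-∷ (_ , _ , refl)    false = refl

lastOr-∷ʳ : ∀ p xs b → lastOr p (xs ++ b ∷ []) ≡ b
lastOr-∷ʳ p []       b = refl
lastOr-∷ʳ p (x ∷ xs) b = lastOr-∷ʳ x xs b

descComp-reverse-∷ : ∀ z b run →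
                     descComp (reverse (z ∷ b ∷ run)) ≡ snocComp (descComp (reverse (b ∷ run))) (z <ᵇ b)
descComp-reverse-∷ z b run
  rewrite List.unfold-reverse z (b ∷ run) | List.unfold-reverse b run = go (reverse run)
  where
  go : ∀ w → descComp ((w ++ b ∷ []) ++ z ∷ []) ≡ snocComp (descComp (w ++ b ∷ [])) (z <ᵇ b)
  go []      = descGo-snoc b 1 [] z
  go (a ∷ w) = trans (descGo-snoc a 1 (w ++ b ∷ []) z)
                     (cong (λ ℓ → snocComp (descGo a 1 (w ++ b ∷ [])) (z <ᵇ ℓ)) (lastOr-∷ʳ a w b))

incLast-∷ʳ : ∀ E c → incLast (E ++ c ∷ []) ≡ E ++ suc c ∷ []
incLast-∷ʳ []           c = refl
incLast-∷ʳ (x ∷ [])     c = refl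
incLast-∷ʳ (x ∷ y ∷ E)  c = cong (x ∷_) (incLast-∷ʳ (y ∷ E) c)

close-part : ∀ E c δ → map (_, false) (E ++ suc c ∷ []) ++ δ ≡ map (_, false) E ++ (c + 1 , false) ∷ δ
close-part E c δ = begin
  map (_, false) (E ++ suc c ∷ []) ++ δ           ≡⟨ cong (_++ δ) (List.map-++ (_, false) E _) ⟩
  (map (_, false) E ++ (suc c , false) ∷ []) ++ δ ≡⟨ List.++-assoc (map (_, false) E) _ δ ⟩
  map (_, false) E ++ (suc c , false) ∷ δ
    ≡⟨ cong (λ x → map (_, false) E ++ (x , false) ∷ δ) (+-comm 1 c) ⟩
  map (_, false) E ++ (c + 1 , false) ∷ δ         ∎

mutual
  -- The accumulator of gammaAcc is the current non-fermionic segment, reversed: its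
  -- descent composition has finished parts E and an open last part suc c.
  gammaAcc-run : ∀ run b X E c → descComp (reverse (b ∷ run)) ≡ E ++ suc c ∷ [] →
                 gammaAcc (b ∷ run) X ≡ map (_, false) E ++ addHead c (γ-run b X)
  gammaAcc-run run b []      E c eq = begin
    map (_, false) (descComp (reverse (b ∷ run))) ≡⟨ cong (map (_, false)) eq ⟩
    map (_, false) (E ++ suc c ∷ [])              ≡⟨ List.map-++ (_, false) E _ ⟩
    map (_, false) E ++ (suc c , false) ∷ []
      ≡⟨ cong (λ x → map (_, false) E ++ (x , false) ∷ []) (+-comm 1 c) ⟩
    map (_, false) E ++ (c + 1 , false) ∷ []      ∎
  gammaAcc-run run b (C ∷ X) E c eq with fermionic C | elem C <ᵇ b in desc
  ... | true  | _     = begin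
    map (_, false) (descComp (reverse (b ∷ run))) ++ (length C ∸ 1 , true) ∷ gammaAcc [] X
      ≡⟨ cong₂ (λ L δ → map (_, false) L ++ (length C ∸ 1 , true) ∷ δ) eq (γ≡γ′ X) ⟩
    map (_, false) (E ++ suc c ∷ []) ++ (length C ∸ 1 , true) ∷ γ′ X
      ≡⟨ close-part E c _ ⟩
    map (_, false) E ++ (c + 1 , false) ∷ (length C ∸ 1 , true) ∷ γ′ X ∎
  ... | false | true  = begin
    gammaAcc (elem C ∷ b ∷ run) X
      ≡⟨ gammaAcc-run (b ∷ run) (elem C) X (E ++ suc c ∷ []) 0
           (trans (descComp-reverse-∷ (elem C) b run) (cong₂ snocComp eq desc)) ⟩
    map (_, false) (E ++ suc c ∷ []) ++ addHead 0 (γ-run (elem C) X)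
      ≡⟨ trans (cong (map (_, false) (E ++ suc c ∷ []) ++_) (addHead-0 _)) (close-part E c _) ⟩
    map (_, false) E ++ (c + 1 , false) ∷ γ-run (elem C) X ∎
  ... | false | false = begin
    gammaAcc (elem C ∷ b ∷ run) X
      ≡⟨ gammaAcc-run (b ∷ run) (elem C) X E (suc c)
           (trans (descComp-reverse-∷ (elem C) b run) (trans (cong₂ snocComp eq desc) (incLast-∷ʳ E (suc c)))) ⟩
    map (_, false) E ++ addHead (suc c) (γ-run (elem C) X)
      ≡⟨ cong (λ k → map (_, false) E ++ addHead k (γ-run (elem C) X)) (+-comm 1 c) ⟩
    map (_, false) E ++ addHead (c + 1) (γ-run (elem C) X)
      ≡⟨ cong (map (_, false) E ++_) (sym (addHead-+ c 1 _)) ⟩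
    map (_, false) E ++ addHead c (addHead 1 (γ-run (elem C) X)) ∎

  γ≡γ′ : ∀ X → γ X ≡ γ′ X
  γ≡γ′ []      = refl
  γ≡γ′ (B ∷ X) with fermionic B
  ... | true  = cong ((length B ∸ 1 , true) ∷_) (γ≡γ′ X)
  ... | false = trans (gammaAcc-run [] (elem B) X [] 0 refl) (addHead-0 _)

-- Shapes of the coarsenings of a superpermutation

0∉singleton : ∀ {a} → 1 ≤ a → 0 ∉ a ∷ []
0∉singleton 1≤a (here refl) = <-irrefl refl 1≤a

blockShape-fermionic : ∀ {B} → 0 ∈ B → blockShape B ≡ (length B ∸ 1 , true)
blockShape-fermionic {B} 0∈B = if-true (dec-true (0 ∈? B) 0∈B)

blockShape-singleton : ∀ {a} → 1 ≤ a → blockShape (a ∷ []) ≡ (1 , false)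
blockShape-singleton 1≤a = blockShape-nonfermionic (0∉singleton 1≤a)

blockShape-∷ : ∀ {a Y} → 1 ≤ a → 0 ∉ Y → blockShape (a ∷ Y) ≡ (suc (length Y) , false)
blockShape-∷ {a} 1≤a 0∉Y = blockShape-nonfermionic ([ 0∉singleton 1≤a , 0∉Y ]′ ∘ ∈-++⁻ (a ∷ []))

NotInHead : ℕ → SSC → Set
NotInHead a []      = ⊤
NotInHead a (B ∷ _) = a ∉ B

-- Superpermutations, with the disjointness of a singleton {a} from the next block built in.
data Superperm : SSC → Set where
  nilᵖ       : Superperm []
  fermionicᵖ : ∀ {B I} → 0 ∈ B → Superperm I → Superperm (B ∷ I)
  singletonᵖ : ∀ {a I} → 1 ≤ a → NotInHead a I → Superperm I → Superperm ((a ∷ []) ∷ I)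

head-⊆ : ∀ {B I Y J} → B ∷ I ≼ˢ Y ∷ J → B ⊆ Y
head-⊆ (keepˢ _)            = id
head-⊆ (mergeˢ {B} {C} _ _) = Subset.xs⊆xs++ys B C

singleton-≼ˢ-head : ∀ {b X Y J} → 1 ≤ b → (b ∷ []) ∷ X ≼ˢ Y ∷ J →
                    0 ∉ Y × (∀ {y} → y ∈ Y → b ≤ y)
singleton-≼ˢ-head 1≤b (keepˢ _) = 0∉singleton 1≤b , λ { (here refl) → ≤-refl }
singleton-≼ˢ-head 1≤b (mergeˢ _ (_ , 0∉C , b<C)) =
  [ 0∉singleton 1≤b , 0∉C ]′ ∘ ∈-++⁻ (_ ∷ []) ,
  λ { (here refl) → ≤-refl ; (there y∈) → <⇒≤ (b<C (here refl) y∈) }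

-- Either the singleton {a} closes its part of γ′, and then it cannot be merged with
-- what follows, or the next block {b} ascends from it and continues the part.
data Next (a : ℕ) : SSC → Set where
  ends   : ∀ {X} → endsPart a X ≡ true →
           (∀ {Y J} → X ≼ˢ Y ∷ J → ¬ Mergeable (a ∷ []) Y) → Next a X
  ascent : ∀ {b X} → 1 ≤ b → a < b → Next a ((b ∷ []) ∷ X)

next : ∀ {a X} → Superperm X → NotInHead a X → Next a X
next nilᵖ _ = ends refl λ ()
next {a} (fermionicᵖ {C} 0∈C _) _ =
  ends (cong (_∨ (elem C <ᵇ a)) (dec-true (0 ∈? C) 0∈C))
       (λ X≼ (_ , 0∉Y , _) → 0∉Y (head-⊆ X≼ 0∈C))
next {a} (singletonᵖ {b} 1≤b _ _) a∉ with <-cmp a b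
... | tri< a<b _ _  = ascent 1≤b a<b
... | tri≈ _ refl _ = ⊥-elim (a∉ (here refl))
... | tri> _ _ b<a  =
  ends (cong₂ _∨_ (dec-false (0 ∈? b ∷ []) (0∉singleton 1≤b)) (<ᵇ≡true b<a))
       (λ X≼ (_ , _ , a<Y) → <-asym b<a (a<Y (here refl) (head-⊆ X≼ (here refl))))

γ′-fermionic : ∀ {B I} → 0 ∈ B → γ′ (B ∷ I) ≡ (length B ∸ 1 , true) ∷ γ′ I
γ′-fermionic {B} 0∈B = if-true (dec-true (0 ∈? B) 0∈B)

γ′-singleton : ∀ {a I} → 1 ≤ a → γ′ ((a ∷ []) ∷ I) ≡ γ-run a I
γ′-singleton {a} 1≤a = if-false (dec-false (0 ∈? a ∷ []) (0∉singleton 1≤a))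

γ-run-ends : ∀ {a X} → endsPart a X ≡ true → γ-run a X ≡ (1 , false) ∷ γ′ X
γ-run-ends = if-true

γ-run-head : ∀ b X → ∃[ c ] ∃[ α ] γ-run b X ≡ (suc c , false) ∷ α
γ-run-head b []      = 0 , [] , refl
γ-run-head b (C ∷ X) with fermionic C | elem C <ᵇ b
... | true  | _     = 0 , _ , refl
... | false | true  = 0 , _ , refl
... | false | false = let c , α , eq = γ-run-head (elem C) X in suc c , α , cong (addHead 1) eq

γ-run-ascent : ∀ {a b X} → 1 ≤ b → a < b →
               ∃[ c ] ∃[ α ] γ′ ((b ∷ []) ∷ X) ≡ (suc c , false) ∷ α ×
                             γ-run a ((b ∷ []) ∷ X) ≡ (suc (suc c) , false) ∷ α
γ-run-ascent {a} {b} {X} 1≤b a<b =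
  let c , α , eq = γ-run-head b X
      γ′≡ = trans (γ′-singleton {I = X} 1≤b) eq
      continues = cong₂ _∨_ (dec-false (0 ∈? b ∷ []) (0∉singleton 1≤b)) (<ᵇ≡false (<⇒≯ a<b))
  in c , α , γ′≡ , trans (if-false continues) (cong (addHead 1) γ′≡)

addHead-≼ᵈ : ∀ {c α β} → β ≼ᵈ (c , false) ∷ α → addHead 1 β ≼ᵈ (suc c , false) ∷ α
addHead-≼ᵈ (keepᵈ β≼)             = keepᵈ β≼
addHead-≼ᵈ (splitᵈ refl _ 1≤q β≼) = splitᵈ refl (s≤s z≤n) 1≤q β≼

≼ᵈ-suc-head⁻ : ∀ {c α β} → β ≼ᵈ (suc c , false) ∷ α →
               (∃[ β′ ] β ≡ (1 , false) ∷ β′ × β′ ≼ᵈ (c , false) ∷ α) ⊎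
               (∃[ β′ ] β ≡ addHead 1 β′ × β′ ≼ᵈ (c , false) ∷ α)
≼ᵈ-suc-head⁻ {c} (keepᵈ {β = β} β≼)       = inj₂ ((c , false) ∷ β , refl , keepᵈ β≼)
≼ᵈ-suc-head⁻ (splitᵈ {a = 1} refl _ _ β≼) = inj₁ (_ , refl , β≼)
≼ᵈ-suc-head⁻ (splitᵈ {a = suc (suc p)} refl _ 1≤q β≼) =
  inj₂ ((suc p , false) ∷ _ , refl , splitᵈ refl (s≤s z≤n) 1≤q β≼)

mutual
  shape-≼ᵈ-γ′ : ∀ {I J} → Superperm I → I ≼ˢ J → shape J ≼ᵈ γ′ I
  shape-≼ᵈ-γ′ nilᵖ nilˢ = nilᵈ
  shape-≼ᵈ-γ′ (fermionicᵖ {B} {I} 0∈B sp) (keepˢ I≼J)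
    rewrite γ′-fermionic {B} {I} 0∈B | blockShape-fermionic 0∈B = dotᵈ (shape-≼ᵈ-γ′ sp I≼J)
  shape-≼ᵈ-γ′ (fermionicᵖ 0∈B _) (mergeˢ _ (0∉B , _)) = ⊥-elim (0∉B 0∈B)
  shape-≼ᵈ-γ′ (singletonᵖ {a} {X} 1≤a a∉ sp) I≼J
    rewrite γ′-singleton {a} {X} 1≤a = shape-≼ᵈ-γ-run 1≤a (next sp a∉) sp I≼J

  shape-≼ᵈ-γ-run : ∀ {a X J} → 1 ≤ a → Next a X → Superperm X → (a ∷ []) ∷ X ≼ˢ J →
                   shape J ≼ᵈ γ-run a X
  shape-≼ᵈ-γ-run {a} {X} 1≤a (ends ends-a _) sp (keepˢ X≼J)
    rewrite γ-run-ends {a} {X} ends-a | blockShape-singleton 1≤a = keepᵈ (shape-≼ᵈ-γ′ sp X≼J)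
  shape-≼ᵈ-γ-run 1≤a (ends _ no-merge) _ (mergeˢ X≼YJ m) = ⊥-elim (no-merge X≼YJ m)
  shape-≼ᵈ-γ-run {a} 1≤a (ascent {b} {X} 1≤b a<b) sp (keepˢ X≼J)
    with γ-run-ascent {a} {b} {X} 1≤b a<b
  ... | c , α , γ′≡ , run≡ rewrite run≡ | blockShape-singleton 1≤a =
    splitᵈ refl (s≤s z≤n) (s≤s z≤n) (subst (_ ≼ᵈ_) γ′≡ (shape-≼ᵈ-γ′ sp X≼J))
  shape-≼ᵈ-γ-run {a} 1≤a (ascent {b} {X} 1≤b a<b) sp (mergeˢ {C = Y} X≼YJ _)
    with γ-run-ascent {a} {b} {X} 1≤b a<b | singleton-≼ˢ-head 1≤b X≼YJ
  ... | c , α , γ′≡ , run≡ | 0∉Y , _ rewrite run≡ | blockShape-∷ {a} {Y} 1≤a 0∉Y =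
    addHead-≼ᵈ (subst₂ _≼ᵈ_ (cong (_∷ _) (blockShape-nonfermionic 0∉Y)) γ′≡
                           (shape-≼ᵈ-γ′ sp X≼YJ))

mutual
  ≼ᵈ-γ′-shape : ∀ {I β} → Superperm I → β ≼ᵈ γ′ I → ∃[ J ] I ≼ˢ J × shape J ≡ β
  ≼ᵈ-γ′-shape nilᵖ nilᵈ = [] , nilˢ , refl
  ≼ᵈ-γ′-shape (fermionicᵖ {B} {I} 0∈B sp) β≼ rewrite γ′-fermionic {B} {I} 0∈B with β≼
  ... | dotᵈ β≼′ =
    let J , I≼J , eq = ≼ᵈ-γ′-shape sp β≼′ in
    B ∷ J , keepˢ I≼J , cong₂ _∷_ (blockShape-fermionic 0∈B) eq
  ≼ᵈ-γ′-shape (singletonᵖ {a} {X} 1≤a a∉ sp) β≼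
    rewrite γ′-singleton {a} {X} 1≤a = ≼ᵈ-γ-run-shape 1≤a (next sp a∉) sp β≼

  ≼ᵈ-γ-run-shape : ∀ {a X β} → 1 ≤ a → Next a X → Superperm X → β ≼ᵈ γ-run a X →
                   ∃[ J ] (a ∷ []) ∷ X ≼ˢ J × shape J ≡ β
  ≼ᵈ-γ-run-shape {a} {X} 1≤a (ends ends-a _) sp β≼ rewrite γ-run-ends {a} {X} ends-a with β≼
  ... | keepᵈ β≼′ =
    let J , X≼J , eq = ≼ᵈ-γ′-shape sp β≼′ in
    (a ∷ []) ∷ J , keepˢ X≼J , cong₂ _∷_ (blockShape-singleton 1≤a) eq
  ... | splitᵈ p+q≡1 1≤p 1≤q _ = case subst (2 ≤_) p+q≡1 (+-mono-≤ 1≤p 1≤q) of λ { (s≤s ()) }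
  ≼ᵈ-γ-run-shape {a} 1≤a (ascent {b} {X} 1≤b a<b) sp β≼ with γ-run-ascent {a} {b} {X} 1≤b a<b
  ... | c , α , γ′≡ , run≡ with ≼ᵈ-suc-head⁻ (subst (_ ≼ᵈ_) run≡ β≼)
  ...   | inj₁ (β′ , refl , β′≼) =
    let J , X≼J , eq = ≼ᵈ-γ′-shape sp (subst (β′ ≼ᵈ_) (sym γ′≡) β′≼) in
    (a ∷ []) ∷ J , keepˢ X≼J , cong₂ _∷_ (blockShape-singleton 1≤a) eq
  ...   | inj₂ (β′ , refl , β′≼) with ≼ᵈ-γ′-shape sp (subst (β′ ≼ᵈ_) (sym γ′≡) β′≼)
  ...     | Y ∷ J , X≼YJ , refl =
    let 0∉Y , b≤Y = singleton-≼ˢ-head 1≤b X≼YJ in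
    (a ∷ Y) ∷ J ,
    mergeˢ X≼YJ (0∉singleton 1≤a , 0∉Y , λ { (here refl) y∈ → <-≤-trans a<b (b≤Y y∈) }) ,
    trans (cong (_∷ shape J) (blockShape-∷ 1≤a 0∉Y))
          (cong (λ s → addHead 1 (s ∷ shape J)) (sym (blockShape-nonfermionic 0∉Y)))

≼ˢ-head-nonempty : ∀ {I Y J} → All (_≢ []) I → I ≼ˢ Y ∷ J → Y ≢ []
≼ˢ-head-nonempty (B≢[] ∷ _) (keepˢ _)                = B≢[]
≼ˢ-head-nonempty (B≢[] ∷ _) (mergeˢ {B = _ ∷ _} _ _) = λ ()
≼ˢ-head-nonempty (B≢[] ∷ _) (mergeˢ {B = []} _ _)    = ⊥-elim (B≢[] refl)

length-merged : ∀ {B Y} → Mergeable B Y → proj₁ (blockShape (B ++ Y)) ≡ length B + length Y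
length-merged {B} (0∉B , 0∉Y , _) =
  trans (cong proj₁ (blockShape-nonfermionic ([ 0∉B , 0∉Y ]′ ∘ ∈-++⁻ B))) (List.length-++ B)

merge-changes-shape : ∀ {B Y} → Mergeable B Y → Y ≢ [] → blockShape B ≢ blockShape (B ++ Y)
merge-changes-shape {B} {[]}    _               Y≢[] _  = Y≢[] refl
merge-changes-shape {B} {y ∷ Y} m@(0∉B , _ , _) _    eq = m≢1+m+n (length B) (begin
  length B                        ≡⟨ cong proj₁ (sym (blockShape-nonfermionic 0∉B)) ⟩
  proj₁ (blockShape B)            ≡⟨ cong proj₁ eq ⟩
  proj₁ (blockShape (B ++ y ∷ Y)) ≡⟨ length-merged m ⟩
  length B + suc (length Y)       ≡⟨ +-suc (length B) (length Y) ⟩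
  suc (length B + length Y)       ∎)

merged-shapes : ∀ {B Y Y′} → Mergeable B Y → Mergeable B Y′ →
                blockShape (B ++ Y) ≡ blockShape (B ++ Y′) → blockShape Y ≡ blockShape Y′
merged-shapes {B} {Y} {Y′} m@(_ , 0∉Y , _) m′@(_ , 0∉Y′ , _) eq = begin
  blockShape Y        ≡⟨ blockShape-nonfermionic 0∉Y ⟩
  (length Y , false)  ≡⟨ cong (_, false) (+-cancelˡ-≡ (length B) _ _ length+≡) ⟩
  (length Y′ , false) ≡⟨ sym (blockShape-nonfermionic 0∉Y′) ⟩
  blockShape Y′       ∎
  where
  length+≡ : length B + length Y ≡ length B + length Y′
  length+≡ = trans (sym (length-merged m)) (trans (cong proj₁ eq) (length-merged m′))

shape-injective : ∀ {I J J′} → All (_≢ []) I → I ≼ˢ J → I ≼ˢ J′ → shape J ≡ shape J′ → J ≡ J′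
shape-injective []       nilˢ nilˢ _ = refl
shape-injective (_ ∷ ne) (keepˢ I≼J) (keepˢ I≼J′) eq =
  cong (_ ∷_) (shape-injective ne I≼J I≼J′ (List.∷-injectiveʳ eq))
shape-injective (_ ∷ ne) (keepˢ _) (mergeˢ I≼YJ m) eq =
  ⊥-elim (merge-changes-shape m (≼ˢ-head-nonempty ne I≼YJ) (List.∷-injectiveˡ eq))
shape-injective (_ ∷ ne) (mergeˢ I≼YJ m) (keepˢ _) eq =
  ⊥-elim (merge-changes-shape m (≼ˢ-head-nonempty ne I≼YJ) (sym (List.∷-injectiveˡ eq)))
shape-injective (_ ∷ ne) (mergeˢ I≼YJ m) (mergeˢ I≼Y′J′ m′) eq
  with shape-injective ne I≼YJ I≼Y′J′
         (cong₂ _∷_ (merged-shapes m m′ (List.∷-injectiveˡ eq)) (List.∷-injectiveʳ eq))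
... | refl = refl

-- Realising a set supercomposition by a monomial

BlocksDisjoint : SSC → Set
BlocksDisjoint []      = ⊤
BlocksDisjoint (B ∷ I) = (∀ {t} → t ∈ B → t ∈ concat I → t ≡ 0) × BlocksDisjoint I

∈-concat⇒lookup : ∀ (I : SSC) {t} → t ∈ concat I → ∃[ k ] t ∈ lookup I k
∈-concat⇒lookup (B ∷ I) t∈ with ∈-++⁻ B t∈
... | inj₁ t∈B = fzero , t∈B
... | inj₂ t∈I = let k , t∈k = ∈-concat⇒lookup I t∈I in fsuc k , t∈k

blocksDisjoint : ∀ I → ((i j : Fin (length I)) → i ≢ j → (t : ℕ) →
                        t ∈ lookup I i → t ∈ lookup I j → t ≡ 0) →
                 BlocksDisjoint I
blocksDisjoint []      _        = tt
blocksDisjoint (B ∷ I) disjoint =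
  (λ {t} t∈B t∈I → let k , t∈k = ∈-concat⇒lookup I t∈I in disjoint fzero (fsuc k) (λ ()) t t∈B t∈k) ,
  blocksDisjoint I (λ i j i≢j → disjoint (fsuc i) (fsuc j) (i≢j ∘ Fin.suc-injective))

singleton-form : ∀ B → 0 ∉ B → length B ≡ 1 → ∃[ a ] B ≡ a ∷ [] × 1 ≤ a
singleton-form (zero  ∷ []) 0∉B _ = ⊥-elim (0∉B (here refl))
singleton-form (suc a ∷ []) _   _ = suc a , refl , s≤s z≤n

superperm : ∀ I → BlocksDisjoint I → All (λ B → ¬ (0 ∈ B) → length B ≡ 1) I → Superperm I
superperm []      _          _           = nilᵖ
superperm (B ∷ I) (B∩I , ds) (size ∷ ss) with 0 ∈? B
... | yes 0∈B = fermionicᵖ 0∈B (superperm I ds ss)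
... | no 0∉B with singleton-form B 0∉B (size 0∉B)
...   | a , refl , 1≤a = singletonᵖ 1≤a (not-in-head I B∩I) (superperm I ds ss)
  where
  not-in-head : ∀ I → (∀ {t} → t ∈ a ∷ [] → t ∈ concat I → t ≡ 0) → NotInHead a I
  not-in-head []      _   = tt
  not-in-head (C ∷ _) a∩I a∈C = <-irrefl (sym (a∩I (here refl) (∈-++⁺ˡ a∈C))) 1≤a

≼ˢ-blocksDisjoint : ∀ {I J} → I ≼ˢ J → BlocksDisjoint I → BlocksDisjoint J
≼ˢ-blocksDisjoint nilˢ        _          = tt
≼ˢ-blocksDisjoint (keepˢ I≼J) (B∩I , ds) =
  (λ t∈B t∈J → B∩I t∈B (subst (_ ∈_) (≼ˢ-concat I≼J) t∈J)) , ≼ˢ-blocksDisjoint I≼J ds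
≼ˢ-blocksDisjoint (mergeˢ {B} {C} {J = J} I≼CJ _) (B∩I , ds) with ≼ˢ-blocksDisjoint I≼CJ ds
... | C∩J , dJ = BC∩J , dJ
  where
  BC∩J : ∀ {t} → t ∈ B ++ C → t ∈ concat J → t ≡ 0
  BC∩J t∈BC t∈J with ∈-++⁻ B t∈BC
  ... | inj₁ t∈B = B∩I t∈B (subst (_ ∈_) (≼ˢ-concat I≼CJ) (∈-++⁺ʳ C t∈J))
  ... | inj₂ t∈C = C∩J t∈C t∈J

≼ˢ-increasing : ∀ {I J} → I ≼ˢ J → All (Linked _<_) I → All (Linked _<_) J
≼ˢ-increasing nilˢ         _          = []
≼ˢ-increasing (keepˢ I≼J)  (B↗ ∷ I↗) = B↗ ∷ ≼ˢ-increasing I≼J I↗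
≼ˢ-increasing (mergeˢ I≼CJ (_ , _ , B<C)) (B↗ ∷ I↗) with ≼ˢ-increasing I≼CJ I↗
... | C↗ ∷ J↗ =
  Linked.AllPairs⇒Linked (AllPairs.++⁺ (Linked.Linked⇒AllPairs <-trans B↗) (Linked.Linked⇒AllPairs <-trans C↗)
                                       (All.tabulate (λ b∈ → All.tabulate (B<C b∈)))) ∷ J↗

interval : ℕ → ℕ → List ℕ
interval t zero    = []
interval t (suc k) = t ∷ interval (suc t) k

∈-interval⁻ : ∀ {s} t k → s ∈ interval t k → t ≤ s × s < t + k
∈-interval⁻ t (suc k) (here refl) = ≤-refl , subst (t <_) (sym (+-suc t k)) (s≤s (m≤m+n t k))
∈-interval⁻ {s} t (suc k) (there s∈) =
  let t<s , s< = ∈-interval⁻ (suc t) k s∈ in <⇒≤ t<s , subst (s <_) (sym (+-suc t k)) s<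

∈-interval⁺ : ∀ {s} t k → t ≤ s → s < t + k → s ∈ interval t k
∈-interval⁺ {s} t zero t≤s s< = ⊥-elim (<-irrefl refl (≤-<-trans t≤s (subst (s <_) (+-identityʳ t) s<)))
∈-interval⁺ {s} t (suc k) t≤s s< with m≤n⇒m<n∨m≡n t≤s
... | inj₂ refl = here refl
... | inj₁ t<s  = there (∈-interval⁺ (suc t) k t<s (subst (s <_) (+-suc t k) s<))

interval-increasing : ∀ t k → Linked _<_ (interval t k)
interval-increasing t zero    = []
interval-increasing t (suc k) = ∷-increasing (proj₁ ∘ ∈-interval⁻ (suc t) k) (interval-increasing (suc t) k)

positions-map-interval : ∀ (f : ℕ → ℕ) j t k →
                         positions j t (map f (interval t k)) ≡ filter (λ s → f s ≟ j) (interval t k)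
positions-map-interval f j t zero    = refl
positions-map-interval f j t (suc k) with does (f t ≟ j)
... | true  = cong (t ∷_) (positions-map-interval f j (suc t) k)
... | false = positions-map-interval f j (suc t) k

label : SSC → List ℕ → ℕ → ℕ
label []      _       t = 0
label (B ∷ J) []      t = 0
label (B ∷ J) (k ∷ K) t = if does (t ∈? B) then k else label J K t

zip-∈ˡ : ∀ {J : SSC} {K : List ℕ} {B k} → (B , k) ∈ zip J K → B ∈ J
zip-∈ˡ {_ ∷ _} {_ ∷ _} (here refl) = here refl
zip-∈ˡ {_ ∷ _} {_ ∷ _} (there p)   = there (zip-∈ˡ p)

zip-∈ʳ : ∀ {J : SSC} {K : List ℕ} {B k} → (B , k) ∈ zip J K → k ∈ K
zip-∈ʳ {_ ∷ _} {_ ∷ _} (here refl) = here refl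
zip-∈ʳ {_ ∷ _} {_ ∷ _} (there p)   = there (zip-∈ʳ p)

zip-∈-partner : ∀ (J : SSC) (K : List ℕ) {k} → length J ≡ length K → k ∈ K → ∃[ B ] (B , k) ∈ zip J K
zip-∈-partner (B ∷ J) (_ ∷ K) _   (here refl) = B , here refl
zip-∈-partner (_ ∷ J) (_ ∷ K) len (there k∈)  =
  let B , p = zip-∈-partner J K (suc-injective len) k∈ in B , there p

map-≡-zip : ∀ {C : Set} (g : List ℕ → C) (h : ℕ → C) (J : SSC) (K : List ℕ) →
            map g J ≡ map h K → ∀ {B k} → (B , k) ∈ zip J K → g B ≡ h k
map-≡-zip g h (_ ∷ J) (_ ∷ K) eq (here refl) = List.∷-injectiveˡ eq
map-≡-zip g h (_ ∷ J) (_ ∷ K) eq (there p)   = map-≡-zip g h J K (List.∷-injectiveʳ eq) p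

map-zip-≡ : ∀ (f : ℕ → List ℕ) (J : SSC) (K : List ℕ) → length J ≡ length K →
            (∀ {B k} → (B , k) ∈ zip J K → f k ≡ B) → map f K ≡ J
map-zip-≡ f []      []      _   _  = refl
map-zip-≡ f (B ∷ J) (k ∷ K) len f≡ =
  cong₂ _∷_ (f≡ (here refl)) (map-zip-≡ f J K (suc-injective len) (f≡ ∘ there))

label-∈ : ∀ {J K B k t} → BlocksDisjoint J → (B , k) ∈ zip J K → 1 ≤ t → t ∈ B → label J K t ≡ k
label-∈ {B′ ∷ J} {_ ∷ K} {t = t} _          (here refl) _   t∈B = if-true (dec-true (t ∈? B′) t∈B)
label-∈ {B′ ∷ J} {_ ∷ K} {t = t} (B′∩J , d) (there p)   1≤t t∈B =
  trans (if-false (dec-false (t ∈? B′) t∉B′)) (label-∈ d p 1≤t t∈B)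
  where
  t∉B′ : t ∉ B′
  t∉B′ t∈B′ = <-irrefl (sym (B′∩J t∈B′ (∈-concat⁺′ t∈B (zip-∈ˡ p)))) 1≤t

label-∈K : ∀ {J K t} → length J ≡ length K → t ∈ concat J → label J K t ∈ K
label-∈K {B ∷ J} {k ∷ K} {t} len t∈ with t ∈? B | ∈-++⁻ B t∈
... | yes _  | _        = here refl
... | no t∉B | inj₁ t∈B = ⊥-elim (t∉B t∈B)
... | no _   | inj₂ t∈J = there (label-∈K {J} (suc-injective len) t∈J)

label-≡ : ∀ {J K B k t} → Linked _<_ K → length J ≡ length K → (B , k) ∈ zip J K →
          t ∈ concat J → label J K t ≡ k → t ∈ B
label-≡ {B′ ∷ J} {k′ ∷ K} {t = t} K↗ len p t∈ eq with t ∈? B′ | p | ∈-++⁻ B′ t∈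
... | yes t∈B′ | here refl | _         = t∈B′
... | yes _    | there p′  | _         = ⊥-elim (<-irrefl eq (head< K↗ (zip-∈ʳ p′)))
... | no t∉B′  | _         | inj₁ t∈B′ = ⊥-elim (t∉B′ t∈B′)
... | no _     | here refl | inj₂ t∈J  =
  ⊥-elim (<-irrefl (sym eq) (head< K↗ (label-∈K {J} (suc-injective len) t∈J)))
... | no _     | there p′  | inj₂ t∈J  = label-≡ (Linked.tail K↗) (suc-injective len) p′ t∈J eq

proj₂-blockShape : ∀ B → proj₂ (blockShape B) ≡ fermionic B
proj₂-blockShape B with fermionic B
... | true  = refl
... | false = refl

-- J = I(u) for the word u whose letter at position t is the index of w paired
-- (in order) with the block of J containing t.
module Realisation {n S e J} (J↗ : All (Linked _<_) J) (J-disjoint : BlocksDisjoint J)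
                   (covering : ∀ t → 1 ≤ t → t ≤ n → t ∈ concat J)
                   (bounded : ∀ {t} → t ∈ concat J → t ≤ n)
                   (shape≡ : shape J ≡ monShape (S , e)) where

  K = indexSet (S , e)
  K↗ = indexSet-increasing (S , e)

  length-J : length J ≡ length K
  length-J = trans (sym (List.length-map blockShape J)) (trans (cong length shape≡) (List.length-map _ K))

  word : List ℕ
  word = map (label J K) (interval 1 n)

  occurrences : ℕ → List ℕ
  occurrences k = filter (λ s → label J K s ≟ k) (interval 1 n)

  occurrences↗ : ∀ k → Linked _<_ (occurrences k)
  occurrences↗ k = Linked.filter⁺ (λ s → label J K s ≟ k) <-trans (interval-increasing 1 n)

  blockShape-paired : ∀ {B k} → (B , k) ∈ zip J K → blockShape B ≡ (count k e , does (k ∈? S))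
  blockShape-paired = map-≡-zip blockShape _ J K shape≡

  fermionic-paired : ∀ {B k} → (B , k) ∈ zip J K → fermionic B ≡ does (k ∈? S)
  fermionic-paired {B} p = trans (sym (proj₂-blockShape B)) (cong proj₂ (blockShape-paired p))

  ∈-occurrences⁻ : ∀ {B k z} → (B , k) ∈ zip J K → z ∈ occurrences k → z ∈ B × 1 ≤ z
  ∈-occurrences⁻ p z∈ =
    let z∈I , lab≡ = ∈-filter⁻ (λ s → label J K s ≟ _) {xs = interval 1 n} z∈
        1≤z , z<1+n = ∈-interval⁻ 1 n z∈I
    in label-≡ K↗ length-J p (covering _ 1≤z (≤-pred z<1+n)) lab≡ , 1≤z

  ∈-occurrences⁺ : ∀ {B k z} → (B , k) ∈ zip J K → 1 ≤ z → z ∈ B → z ∈ occurrences k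
  ∈-occurrences⁺ p 1≤z z∈B =
    ∈-filter⁺ (λ s → label J K s ≟ _)
      (∈-interval⁺ 1 n 1≤z (s≤s (bounded (∈-concat⁺′ z∈B (zip-∈ˡ p)))))
      (label-∈ J-disjoint p 1≤z z∈B)

  blockOf-word : ∀ {B k} → (B , k) ∈ zip J K → blockOf (S , word) k ≡ B
  blockOf-word {B} {k} p rewrite positions-map-interval (label J K) k 1 n with k ∈? S
  ... | yes k∈S =
    increasing-ext (∷-increasing (proj₂ ∘ ∈-occurrences⁻ p) (occurrences↗ k)) (All.lookup J↗ (zip-∈ˡ p))
      (λ { (here refl) → does≡true⇒ (0 ∈? B) (trans (fermionic-paired p) (dec-true (k ∈? S) k∈S))
         ; (there z∈)  → proj₁ (∈-occurrences⁻ p z∈) })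
      (λ { {zero} _     → here refl
         ; {suc _} z∈B → there (∈-occurrences⁺ p (s≤s z≤n) z∈B) })
  ... | no k∉S =
    increasing-ext (occurrences↗ k) (All.lookup J↗ (zip-∈ˡ p))
      (proj₁ ∘ ∈-occurrences⁻ p)
      (λ { {zero} 0∈B →
             ⊥-elim (k∉S (does≡true⇒ (k ∈? S) (trans (sym (fermionic-paired p)) (dec-true (0 ∈? B) 0∈B))))
         ; {suc _} z∈B → ∈-occurrences⁺ p (s≤s z≤n) z∈B })

  word-sameContent : SameContent word e
  word-sameContent i with i ∈? K
  ... | yes i∈K = let B , p = zip-∈-partner J K length-J i∈K in begin
    count i word                              ≡⟨ cong proj₁ (sym (blockShape-blockOf S word i)) ⟩
    proj₁ (blockShape (blockOf (S , word) i)) ≡⟨ cong (proj₁ ∘ blockShape) (blockOf-word p) ⟩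
    proj₁ (blockShape B)                      ≡⟨ cong proj₁ (blockShape-paired p) ⟩
    count i e                                 ∎
  ... | no i∉K = trans (count-∉ word i∉word) (sym (count-∉ e (i∉K ∘ letters-⊆-indexSet S e)))
    where
    i∉word : i ∉ word
    i∉word i∈ with ∈-map⁻ (label J K) i∈
    ... | s , s∈ , refl =
      let 1≤s , s<1+n = ∈-interval⁻ 1 n s∈ in i∉K (label-∈K {J} length-J (covering s 1≤s (≤-pred s<1+n)))

  Iof-word : Iof (S , word) ≡ J
  Iof-word = trans (cong (map (blockOf (S , word))) (indexSet-sameContent S word-sameContent))
                   (map-zip-≡ (blockOf (S , word)) J K length-J blockOf-word)

addHead-isDC : ∀ α → IsDottedComposition α → IsDottedComposition (addHead 1 α)
addHead-isDC []      _          = []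
addHead-isDC (_ ∷ _) (_ ∷ α-dc) = (λ _ → s≤s z≤n) ∷ α-dc

mutual
  γ′-isDC : ∀ I → IsDottedComposition (γ′ I)
  γ′-isDC []      = []
  γ′-isDC (B ∷ I) with fermionic B
  ... | true  = (λ ()) ∷ γ′-isDC I
  ... | false = γ-run-isDC (elem B) I

  γ-run-isDC : ∀ b I → IsDottedComposition (γ-run b I)
  γ-run-isDC b I with endsPart b I
  ... | true  = (λ _ → s≤s z≤n) ∷ γ′-isDC I
  ... | false = addHead-isDC (γ′ I) (γ′-isDC I)

γ-isDC : ∀ I → IsDottedComposition (γ I)
γ-isDC I = subst IsDottedComposition (sym (γ≡γ′ I)) (γ′-isDC I)

≼ᵈ-isDC : ∀ {α β} → β ≼ᵈ α → IsDottedComposition α → IsDottedComposition β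
≼ᵈ-isDC nilᵈ                  []         = []
≼ᵈ-isDC (dotᵈ β≼)             (p ∷ α-dc) = p ∷ ≼ᵈ-isDC β≼ α-dc
≼ᵈ-isDC (keepᵈ β≼)            (p ∷ α-dc) = p ∷ ≼ᵈ-isDC β≼ α-dc
≼ᵈ-isDC (splitᵈ _ 1≤a 1≤b β≼) (_ ∷ α-dc) = (λ _ → 1≤a) ∷ ≼ᵈ-isDC β≼ ((λ _ → 1≤b) ∷ α-dc)

module _ {α} (α-dc : IsDottedComposition α) where

  downset-isDC : ∀ {β} → β ∈ downset α → IsDottedComposition β
  downset-isDC β∈ = ≼ᵈ-isDC (∈-downset⁻ α β∈) α-dc

  Lcoeff-∈ : ∀ {w} → IsCMon w → monShape w ∈ downset α → Lcoeff α w ≡ 1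
  Lcoeff-∈ {w} w-cmon shape∈ =
    sum-map-≡1 (λ β → MDcoeff β w) (downset α) (DecUnique.deduplicate-! _≟D_ _) shape∈
      (MDcoeff-monShape w-cmon) (λ β∈ β≢ → MDcoeff-≢monShape w (downset-isDC β∈) β≢)

  Lcoeff-∉ : ∀ w → monShape w ∉ downset α → Lcoeff α w ≡ 0
  Lcoeff-∉ w shape∉ =
    sum-map-≡0 (λ β → MDcoeff β w) (downset α)
      (λ β∈ → MDcoeff-≢monShape w (downset-isDC β∈) (λ { refl → shape∉ β∈ }))

Qcoeff-∈upset : ∀ I u → Iof u ∈ upset I → Qcoeff I u ≡ 1
Qcoeff-∈upset I u I∈ =
  sum-map-≡1 (λ J → Mcoeff J u) (upset I) (DecUnique.deduplicate-! _≟S_ _) I∈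
    (if-true (dec-true (Iof u ≟S Iof u) refl)) (λ _ J≢ → if-false (dec-false (Iof u ≟S _) (J≢ ∘ sym)))

Qcoeff-∉upset : ∀ I u → Iof u ∉ upset I → Qcoeff I u ≡ 0
Qcoeff-∉upset I u I∉ =
  sum-map-≡0 (λ J → Mcoeff J u) (upset I) (λ J∈ → if-false (dec-false (Iof u ≟S _) (λ { refl → I∉ J∈ })))

fibre : Mon → List (List ℕ)
fibre (S , e) = filter (λ v → πmon (S , v) ≟M (S , e)) (words (length e) (alphabet (S , e)))

fibre-unique : ∀ w → Unique (fibre w)
fibre-unique (S , e) =
  Unique.filter⁺ (λ v → πmon (S , v) ≟M (S , e)) (words-unique (length e) _ (Unique.upTo⁺ _))

∈-fibre⁻ : ∀ S e {v} → v ∈ fibre (S , e) → SameContent v e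
∈-fibre⁻ S e {v} v∈ i = trans (sym (count-isort i v)) (cong (count i ∘ proj₂) π≡)
  where
  π≡ : πmon (S , v) ≡ (S , e)
  π≡ = proj₂ (∈-filter⁻ (λ v → πmon (S , v) ≟M (S , e)) {xs = words (length e) (alphabet (S , e))} v∈)

∈-fibre⁺ : ∀ {S e v} → Linked _≤_ e → SameContent v e → v ∈ fibre (S , e)
∈-fibre⁺ {S} {e} {v} e↗ same =
  ∈-filter⁺ (λ v → πmon (S , v) ≟M (S , e))
    (subst (λ k → v ∈ words k (alphabet (S , e))) (trans (sym (length-isort v)) (cong length sorted≡))
      (∈-words⁺ _ v (All.tabulate in-alphabet)))
    (cong (S ,_) sorted≡)
  where
  sorted≡ : isort v ≡ e
  sorted≡ = sorted-sameContent-≡ (isort-sorted v) e↗ (λ i → trans (count-isort i v) (same i))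
  in-alphabet : v ⊆ alphabet (S , e)
  in-alphabet = proj₁ ∘ ∈-filter⁻ (λ j → j ∈? (S ++ e)) ∘ letters-⊆-indexSet S e ∘ ∈-sameContent same

module _ {n m I} (I-sp : IsSuperpermutation n m I) where
  open IsSuperpermutation I-sp using (ssc; singletons)
  open IsSetSupercomposition ssc using (sorted; nonempty; disjoint; covering; bounded)

  I-disjoint : BlocksDisjoint I
  I-disjoint = blocksDisjoint I disjoint

  I-superperm : Superperm I
  I-superperm = superperm I I-disjoint singletons

  I-covering : ∀ t → 1 ≤ t → t ≤ n → t ∈ concat I
  I-covering t 1≤t t≤n = let i , t∈ = covering t 1≤t t≤n in ∈-concat⁺′ t∈ (∈-lookup {xs = I} i)

  I-bounded : ∀ {t} → t ∈ concat I → t ≤ n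
  I-bounded t∈ = let B , t∈B , B∈ = ∈-concat⁻′ I t∈ in All.lookup (All.lookup bounded B∈) t∈B

  shape-fibre : ∀ S e {v} → v ∈ fibre (S , e) → Iof (S , v) ∈ upset I → monShape (S , e) ∈ downset (γ I)
  shape-fibre S e v∈ up = subst (_∈ downset (γ I)) (shape-Iof S (∈-fibre⁻ S e v∈))
    (∈-downset⁺ (subst (_ ≼ᵈ_) (sym (γ≡γ′ I)) (shape-≼ᵈ-γ′ I-superperm (∈-upset⁻ I up))))

  πcoeff-Qcoeff-∉ : ∀ S e → monShape (S , e) ∉ downset (γ I) → πcoeff (Qcoeff I) (S , e) ≡ 0
  πcoeff-Qcoeff-∉ S e shape∉ =
    sum-map-≡0 (λ v → Qcoeff I (S , v)) (fibre (S , e))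
      (λ {v} v∈ → Qcoeff-∉upset I (S , v) (shape∉ ∘ shape-fibre S e v∈))

  -- The only monomial of the fibre counted by Q_I realises the coarsening J of I
  -- whose shape is monShape (S , e).
  πcoeff-Qcoeff-∈ : ∀ S e → Linked _≤_ e → monShape (S , e) ∈ downset (γ I) →
                    πcoeff (Qcoeff I) (S , e) ≡ 1
  πcoeff-Qcoeff-∈ S e e↗ shape∈
    with ≼ᵈ-γ′-shape I-superperm (subst (_ ≼ᵈ_) (γ≡γ′ I) (∈-downset⁻ (γ I) shape∈))
  ... | J , I≼J , shapeJ≡ =
    sum-map-≡1 (λ v → Qcoeff I (S , v)) (fibre (S , e)) (fibre-unique (S , e)) (∈-fibre⁺ e↗ word-sameContent)
      (Qcoeff-∈upset I (S , word) (subst (_∈ upset I) (sym Iof-word) (∈-upset⁺ I≼J))) others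
    where
    open Realisation {n} {S} {e} {J} (≼ˢ-increasing I≼J sorted) (≼ˢ-blocksDisjoint I≼J I-disjoint)
           (λ t 1≤t t≤n → subst (t ∈_) (sym (≼ˢ-concat I≼J)) (I-covering t 1≤t t≤n))
           (I-bounded ∘ subst (_ ∈_) (≼ˢ-concat I≼J)) shapeJ≡
    others : ∀ {v} → v ∈ fibre (S , e) → v ≢ word → Qcoeff I (S , v) ≡ 0
    others {v} v∈ v≢ = Qcoeff-∉upset I (S , v) λ up →
      let same  = λ i → trans (∈-fibre⁻ S e v∈ i) (sym (word-sameContent i))
          Iof≡J = shape-injective nonempty (∈-upset⁻ I up) I≼J
                    (trans (shape-Iof S (∈-fibre⁻ S e v∈)) (sym shapeJ≡))
      in v≢ (Iof-injective S same (trans Iof≡J (sym Iof-word)))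

proposition5p11 : (n m : ℕ) (I : SSC) → IsSuperpermutation n m I →
    (w : Mon) → IsCMon w → πcoeff (Qcoeff I) w ≡ Lcoeff (γ I) w
proposition5p11 n m I I-sp (S , e) w-cmon@(_ , e↗) with monShape (S , e) ∈ᵈ? downset (γ I)
... | yes shape∈ = trans (πcoeff-Qcoeff-∈ I-sp S e e↗ shape∈) (sym (Lcoeff-∈ (γ-isDC I) w-cmon shape∈))
... | no shape∉  = trans (πcoeff-Qcoeff-∉ I-sp S e shape∉) (sym (Lcoeff-∉ (γ-isDC I) (S , e) shape∉))
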